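{- Let $t$ be the Thue–Morse word and for a finite word $u$ let $\mathcal{A}_u(n)$ be the number of privileged factors of $t$ of length $n$ having $u$ as a prefix. Then for all $n\ge2$, $\mathcal{A}_{010}(4n)=\mathcal{A}_{010}(n+1)+\mathcal{A}_{0110}(n+1)$ and $\mathcal{A}_{010}(4n-2)=\mathcal{A}_{010}(4n)$.
   Context: The Thue–Morse word $t$ is the fixed point beginning with $0$ of the morphism $0\mapsto01,\ 1\mapsto10$. A complete first return to a word $v$ is a word that begins with $v$, ends with $v$, and contains exactly two occurrences of $v$. Privileged words: the empty word and every letter are privileged, and a word is privileged if it is a complete first return to a shorter privileged word. -}

module Defs where

open import Data.Bool using (Bool; true; false; not; if_then_else_; _∧_)
open import Data.Nat using (ℕ; zero; suc; _+_; _<_)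
open import Data.List using (List; []; _∷_; _++_; length; concatMap; map; upTo)
open import Data.Product using (Σ; _×_; _,_)
open import Relation.Binary.PropositionalEquality using (_≡_)
open import Data.List.Relation.Unary.Unique.Propositional using (Unique)
open import Data.List.Membership.Propositional using (_∈_)

-- Words over the alphabet {0,1}; letter 0 is 'false', letter 1 is 'true'.
Word : Set
Word = List Bool

μ : Word → Word
μ = concatMap (λ b → b ∷ not b ∷ [])

μ^ : ℕ → Word → Word
μ^ zero    w = w
μ^ (suc k) w = μ (μ^ k w)

nthOr : Bool → Word → ℕ → Bool
nthOr d []       _       = d
nthOr d (x ∷ xs) zero    = x
nthOr d (x ∷ xs) (suc i) = nthOr d xs i

-- The Thue–Morse word t (fixed point of μ starting with 0):
-- t i is the i-th letter of μ^(i+1)(0), a prefix of t of length 2^(i+1) > i.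
t : ℕ → Bool
t i = nthOr false (μ^ (suc i) (false ∷ [])) i

slice : ℕ → ℕ → Word
slice i n = map (λ j → t (i + j)) (upTo n)

IsFactor : Word → Set
IsFactor w = Σ ℕ λ i → w ≡ slice i (length w)

IsPrefix : Word → Word → Set
IsPrefix v w = Σ Word λ r → w ≡ v ++ r

IsSuffix : Word → Word → Set
IsSuffix v w = Σ Word λ r → w ≡ r ++ v

-- Boolean prefix test and number of occurrences (overlaps counted).
_==b_ : Bool → Bool → Bool
true  ==b true  = true
false ==b false = true
_     ==b _     = false

isPrefixB : Word → Word → Bool
isPrefixB []       _        = true
isPrefixB (_ ∷ _)  []       = false
isPrefixB (x ∷ xs) (y ∷ ys) = (x ==b y) ∧ isPrefixB xs ys

occ : Word → Word → ℕ
occ v []         = if isPrefixB v [] then 1 else 0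
occ v (x ∷ xs)   = (if isPrefixB v (x ∷ xs) then 1 else 0) + occ v xs

CompleteFirstReturn : Word → Word → Set
CompleteFirstReturn v w = IsPrefix v w × IsSuffix v w × occ v w ≡ 2

data Privileged : Word → Set where
  priv-empty  : Privileged []
  priv-letter : ∀ a → Privileged (a ∷ [])
  priv-return : ∀ {v w} → Privileged v → length v < length w →
                CompleteFirstReturn v w → Privileged w

-- "the number of words satisfying P is k": there is a duplicate-free list
-- of length k whose members are exactly the words satisfying P.
HasCount : (Word → Set) → ℕ → Set
HasCount P k = Σ (List Word) λ xs →
  length xs ≡ k × Unique xs × (∀ w → (w ∈ xs → P w) × (P w → w ∈ xs))

PrivFactorWithPrefix : Word → ℕ → Word → Set
PrivFactorWithPrefix u n w =
  length w ≡ n × IsFactor w × Privileged w × IsPrefix u w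

𝒜≡ : Word → ℕ → ℕ → Set
𝒜≡ u n k = HasCount (PrivFactorWithPrefix u n) k

w010 : Word
w010 = false ∷ true ∷ false ∷ []

w0110 : Word
w0110 = false ∷ true ∷ true ∷ false ∷ []

-- Let S be the set of privileged factors of length n + 1 beginning with 01.
-- Two codings, φ (μ² of the complement, trimmed by two letters at each end)
-- and ψ (μ², trimmed by three letters at each end), send the factor of
-- length m at position q to the factors of lengths 4m − 4 and 4m − 6 at
-- positions 4q + 2 and 4q + 3.  On words beginning with 01 both preserve and
-- reflect prefixes, suffixes and occurrence counts, hence complete first
-- returns, hence (by induction on the length, short words by evaluation)
-- privilegedness.  The position-class theorem -- a privileged factor of
-- length L ≥ 4 beginning with 010 at position i has (i, L) ≡ (2, 0) or (3, 2)
-- modulo 4 -- shows that every privileged factor of length 4n (resp. 4n − 2)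
-- beginning with 010 is a φ-image (resp. ψ-image), so both counts equal |S|.
-- Finally S splits by the prefixes 010 and 0110, as 011 is not privileged
-- and 111 is not a factor of t.
module Submission where

open import Defs
open import Data.Bool using (Bool; true; false; not; T; _∧_; _∨_; if_then_else_)
open import Data.Bool.Properties using (T-∧; T-∨; T?; not-involutive; ∧-zeroʳ) renaming (_≟_ to _≟ᴮ_)
open import Data.Empty using (⊥-elim)
open import Data.List using (List; []; _∷_; _++_; length; map; take; drop; applyUpTo; filterᵇ; deduplicate)
open import Data.List.Properties
  using (++-assoc; ++-identityʳ; length-++; length-++-≤ʳ; length-drop; length-map; map-upTo; take++drop≡id; ∷-injective; ≡-dec)
open import Data.List.Membership.Propositional using (_∈_)
open import Data.List.Membership.Propositional.Properties
  using (∈-deduplicate⁺; ∈-deduplicate⁻; ∈-filter⁺; ∈-filter⁻; ∈-map⁺; ∈-map⁻)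
open import Data.List.Relation.Unary.Any using (here; there)
import Data.List.Relation.Unary.All as All
import Data.List.Relation.Unary.All.Properties as All
open import Data.List.Relation.Unary.Unique.Propositional using (Unique; []; _∷_)
open import Data.List.Relation.Unary.Unique.DecPropositional.Properties (≡-dec _≟ᴮ_) using (deduplicate-!; filter⁺)
open import Data.Nat using (ℕ; zero; suc; _+_; _*_; _∸_; _%_; _/_; _<_; _≤_; _<?_; _≤?_; _≤ᵇ_; _≡ᵇ_; z≤n; s≤s)
open import Data.Nat.Properties
  using (≤-refl; ≤-trans; ≤-pred; <⇒≤; <⇒≱; ≰⇒>; ≮⇒≥; ≤∧≢⇒<; <-irrefl; m≤n⇒m≤1+n; m≤m+n; m≤n+m; suc-injective;
         +-assoc; +-comm; +-identityʳ; +-suc; +-cancelʳ-≡; +-mono-≤; +-mono-<; *-assoc; *-comm; *-identityʳ;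
         *-distribˡ-+; *-cancelʳ-<; m+n∸n≡m; m+[n∸m]≡n; m∸[m∸n]≡n; m+n≤o⇒m≤o∸n; ∸-monoˡ-<; ∸-monoˡ-≤;
         ≡ᵇ⇒≡; ≤ᵇ⇒≤; ≤⇒≤ᵇ)
  renaming (_≟_ to _≟ℕ_)
open import Data.Nat.DivMod using (%-distribˡ-+; [m+kn]%n≡m%n; m%n%n≡m%n; m%n<n; m≡m%n+[m/n]*n)
open import Data.Nat.Induction using (<-rec)
open import Data.Product using (Σ; _×_; _,_; proj₁; proj₂)
open import Data.Sum using (_⊎_; inj₁; inj₂)
open import Function.Bundles using (Equivalence)
open import Relation.Nullary using (¬_; Dec; yes; no)
open import Relation.Nullary.Decidable using (⌊_⌋; toWitness; fromWitness)
open import Relation.Binary.PropositionalEquality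
  using (_≡_; _≢_; refl; sym; trans; cong; cong₂; subst; subst₂; module ≡-Reasoning)
open ≡-Reasoning
open Equivalence using (to; from)

w01 : Word
w01 = false ∷ true ∷ []

_≟ᵂ_ : (u v : Word) → Dec (u ≡ v)
_≟ᵂ_ = ≡-dec _≟ᴮ_

drop-length-++ : ∀ (u v : Word) → drop (length u) (u ++ v) ≡ v
drop-length-++ []      v = refl
drop-length-++ (x ∷ u) v = drop-length-++ u v

length-take-≤ : ∀ n (w : Word) → n ≤ length w → length (take n w) ≡ n
length-take-≤ zero    w       _       = refl
length-take-≤ (suc n) (x ∷ w) (s≤s p) = cong suc (length-take-≤ n w p)

++-split-eqˡ : ∀ (a b c d : Word) → a ++ b ≡ c ++ d → length a ≡ length c → a ≡ c × b ≡ d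
++-split-eqˡ []      b []      d e _ = refl , e
++-split-eqˡ (x ∷ a) b (y ∷ c) d e l with ∷-injective e
... | refl , e′ with ++-split-eqˡ a b c d e′ (suc-injective l)
... | refl , b≡d = refl , b≡d

++-split-eqʳ : ∀ (a b c d : Word) → a ++ b ≡ c ++ d → length b ≡ length d → a ≡ c × b ≡ d
++-split-eqʳ a b c d e l = ++-split-eqˡ a b c d e (+-cancelʳ-≡ (length b) (length a) (length c) lengths)
  where
  lengths : length a + length b ≡ length c + length b
  lengths = trans (sym (length-++ a)) (trans (cong length e) (trans (length-++ c) (cong (length c +_) (sym l))))

prefix-length : ∀ (u w : Word) → IsPrefix u w → length u ≤ length w
prefix-length u .(u ++ r) (r , refl) = subst (length u ≤_) (sym (length-++ u)) (m≤m+n _ _)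

suffix-length : ∀ (u w : Word) → IsSuffix u w → length u ≤ length w
suffix-length u .(r ++ u) (r , refl) = subst (length u ≤_) (sym (length-++ r)) (m≤n+m _ _)

take-prefix : ∀ k (w : Word) → IsPrefix (take k w) w
take-prefix k w = drop k w , sym (take++drop≡id k w)

prefix-of-prefix : ∀ (u v w : Word) → IsPrefix u w → IsPrefix v w → length u ≤ length v → IsPrefix u v
prefix-of-prefix []      v       w       _        _        _       = v , refl
prefix-of-prefix (x ∷ u) (y ∷ v) (z ∷ w) (r , e₁) (s , e₂) (s≤s l) with ∷-injective e₁ | ∷-injective e₂
... | refl , e₁′ | refl , e₂′ with prefix-of-prefix u v w (r , e₁′) (s , e₂′) l
... | q , e = q , cong (x ∷_) e

prefix-refl : ∀ (w : Word) → IsPrefix w w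
prefix-refl w = [] , sym (++-identityʳ w)

prefix-trans : ∀ {u v w : Word} → IsPrefix u v → IsPrefix v w → IsPrefix u w
prefix-trans {u} (r , refl) (s , refl) = r ++ s , ++-assoc u r s

suffix-trans : ∀ {u v w : Word} → IsSuffix u v → IsSuffix v w → IsSuffix u w
suffix-trans {u} (r , refl) (s , refl) = s ++ r , sym (++-assoc s r u)

prefix-unique : ∀ (u v w : Word) → IsPrefix u w → IsPrefix v w → length u ≡ length v → u ≡ v
prefix-unique u v w (r , refl) (s , e) l = proj₁ (++-split-eqˡ u r v s e l)

prefix01-long : ∀ (v : Word) → IsPrefix w01 v → 3 ≤ length v →
  Σ Bool λ a → Σ Word λ v′ → v ≡ false ∷ true ∷ a ∷ v′
prefix01-long .(false ∷ true ∷ a ∷ v′) (a ∷ v′ , refl) _ = a , v′ , refl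
prefix01-long .(false ∷ true ∷ []) ([] , refl) (s≤s (s≤s ()))

_⇒ᵇ_ : Bool → Bool → Bool
p ⇒ᵇ q = not p ∨ q

⇒ᵇ-mp : ∀ {p q} → T (p ⇒ᵇ q) → T p → T q
⇒ᵇ-mp {true} h _ = h

==b-not : ∀ a b → (not a ==b not b) ≡ (a ==b b)
==b-not true  true  = refl
==b-not true  false = refl
==b-not false true  = refl
==b-not false false = refl

∧-dup : ∀ x y → x ∧ (x ∧ y) ≡ x ∧ y
∧-dup true  y = refl
∧-dup false y = refl

T-∧⁻ : ∀ {p q} → T (p ∧ q) → T p × T q
T-∧⁻ = to T-∧

T-∧⁺ : ∀ {p q} → T p → T q → T (p ∧ q)
T-∧⁺ x y = from T-∧ (x , y)

==b-sound : ∀ a b → T (a ==b b) → a ≡ b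
==b-sound true  true  _ = refl
==b-sound false false _ = refl

==b-refl : ∀ a → T (a ==b a)
==b-refl true  = _
==b-refl false = _

isPrefixB-sound : ∀ (v w : Word) → T (isPrefixB v w) → IsPrefix v w
isPrefixB-sound []      w       _ = w , refl
isPrefixB-sound (x ∷ v) (y ∷ w) h with T-∧⁻ {x ==b y} h
... | hx , hv with ==b-sound x y hx | isPrefixB-sound v w hv
... | refl | r , refl = r , refl

isPrefixB-complete : ∀ (v w : Word) → IsPrefix v w → T (isPrefixB v w)
isPrefixB-complete []      w               _        = _
isPrefixB-complete (x ∷ v) .(x ∷ v ++ r) (r , refl) = T-∧⁺ (==b-refl x) (isPrefixB-complete v (v ++ r) (r , refl))

isSuffixB : Word → Word → Bool
isSuffixB v w = ⌊ drop (length w ∸ length v) w ≟ᵂ v ⌋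

isSuffixB-sound : ∀ (v w : Word) → T (isSuffixB v w) → IsSuffix v w
isSuffixB-sound v w h = take k w , trans (sym (take++drop≡id k w)) (cong (take k w ++_) (toWitness {a? = drop k w ≟ᵂ v} h))
  where
  k : ℕ
  k = length w ∸ length v

isSuffixB-complete : ∀ (v w : Word) → IsSuffix v w → T (isSuffixB v w)
isSuffixB-complete v .(r ++ v) (r , refl) = fromWitness {a? = drop (length (r ++ v) ∸ length v) (r ++ v) ≟ᵂ v} dropped
  where
  dropped : drop (length (r ++ v) ∸ length v) (r ++ v) ≡ v
  dropped = trans (cong (λ k → drop (k ∸ length v) (r ++ v)) (length-++ r))
                  (trans (cong (λ k → drop k (r ++ v)) (m+n∸n≡m (length r) (length v))) (drop-length-++ r v))

any< : (ℕ → Bool) → ℕ → Bool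
any< p zero    = false
any< p (suc n) = any< p n ∨ p n

all< : (ℕ → Bool) → ℕ → Bool
all< p zero    = true
all< p (suc n) = all< p n ∧ p n

any<-sound : ∀ p n → T (any< p n) → Σ ℕ λ k → k < n × T (p k)
any<-sound p (suc n) h with to (T-∨ {any< p n}) h
... | inj₁ h′ with any<-sound p n h′
...   | k , k<n , pk = k , m≤n⇒m≤1+n k<n , pk
any<-sound p (suc n) h | inj₂ pn = n , ≤-refl , pn

any<-complete : ∀ p n k → k < n → T (p k) → T (any< p n)
any<-complete p (suc n) k (s≤s k≤n) pk with k ≟ℕ n
... | yes refl = from (T-∨ {any< p n}) (inj₂ pk)
... | no k≢n   = from (T-∨ {any< p n}) (inj₁ (any<-complete p n k (≤∧≢⇒< k≤n k≢n) pk))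

all<-sound : ∀ p n → T (all< p n) → ∀ k → k < n → T (p k)
all<-sound p (suc n) h k (s≤s k≤n) with T-∧⁻ {all< p n} h | k ≟ℕ n
... | _  , pn | yes refl = pn
... | h′ , _  | no k≢n   = all<-sound p n h′ k (≤∧≢⇒< k≤n k≢n)

-- A word of length ≥ 2 is privileged iff one of
-- its proper prefixes is privileged and the word is a complete first return
-- to it; the fuel f bounds the depth of this recursion.
cfrB : Word → Word → Bool
cfrB v w = isSuffixB v w ∧ ⌊ occ v w ≟ℕ 2 ⌋

privilegedF : ℕ → Word → Bool
privilegedF _       []              = true
privilegedF _       (_ ∷ [])        = true
privilegedF zero    (_ ∷ _ ∷ _)     = false
privilegedF (suc f) w@(_ ∷ _ ∷ _) = any< (λ k → cfrB (take k w) w ∧ privilegedF f (take k w)) (length w)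

privB : Word → Bool
privB w = privilegedF (length w) w

privilegedF-sound : ∀ f w → T (privilegedF f w) → Privileged w
privilegedF-sound _       []              _ = priv-empty
privilegedF-sound _       (a ∷ [])        _ = priv-letter a
privilegedF-sound (suc f) w@(_ ∷ _ ∷ _) h with any<-sound _ (length w) h
... | k , k<|w| , hk with T-∧⁻ {cfrB (take k w) w} hk
... | hcfr , hpriv with T-∧⁻ {isSuffixB (take k w) w} hcfr
... | hsuf , hocc =
  priv-return (privilegedF-sound f (take k w) hpriv)
    (subst (_< length w) (sym (length-take-≤ k w (<⇒≤ k<|w|))) k<|w|)
    (take-prefix k w , isSuffixB-sound (take k w) w hsuf , toWitness {a? = occ (take k w) w ≟ℕ 2} hocc)

privilegedF-complete : ∀ f w → Privileged w → length w ≤ f → T (privilegedF f w)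
privilegedF-complete _ [] _ _ = _
privilegedF-complete _ (a ∷ []) _ _ = _
privilegedF-complete (suc f) w@(_ ∷ _ ∷ _) (priv-return {v} pv |v|<|w| (pre , suf , oc)) (s≤s |w|≤f) =
  any<-complete _ (length w) (length v) |v|<|w|
    (subst (λ u → T (cfrB u w ∧ privilegedF f u)) (sym take-v)
      (T-∧⁺ (T-∧⁺ (isSuffixB-complete v w suf) (fromWitness {a? = occ v w ≟ℕ 2} oc))
            (privilegedF-complete f v pv (≤-trans (≤-pred |v|<|w|) |w|≤f))))
  where
  take-v : take (length v) w ≡ v
  take-v = prefix-unique (take (length v) w) v w (take-prefix (length v) w) pre
             (length-take-≤ (length v) w (<⇒≤ |v|<|w|))

privB-sound : ∀ w → T (privB w) → Privileged w
privB-sound w = privilegedF-sound (length w) w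

privB-complete : ∀ w → Privileged w → T (privB w)
privB-complete w p = privilegedF-complete (length w) w p ≤-refl

complement : Word → Word
complement = map not

μ-++ : ∀ u v → μ (u ++ v) ≡ μ u ++ μ v
μ-++ []      v = refl
μ-++ (x ∷ u) v = cong (λ w → x ∷ not x ∷ w) (μ-++ u v)

μ^-++ : ∀ k u v → μ^ k (u ++ v) ≡ μ^ k u ++ μ^ k v
μ^-++ zero    u v = refl
μ^-++ (suc k) u v = trans (cong μ (μ^-++ k u v)) (μ-++ (μ^ k u) (μ^ k v))

μ^-μ : ∀ k w → μ^ k (μ w) ≡ μ (μ^ k w)
μ^-μ zero    w = refl
μ^-μ (suc k) w = cong μ (μ^-μ k w)

μ-complement : ∀ w → μ (complement w) ≡ complement (μ w)
μ-complement []      = refl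
μ-complement (x ∷ w) = cong (λ u → not x ∷ not (not x) ∷ u) (μ-complement w)

μ^-complement : ∀ k w → μ^ k (complement w) ≡ complement (μ^ k w)
μ^-complement zero    w = refl
μ^-complement (suc k) w = trans (cong μ (μ^-complement k w)) (μ-complement (μ^ k w))

complement-involutive : ∀ w → complement (complement w) ≡ w
complement-involutive []      = refl
complement-involutive (x ∷ w) = cong₂ _∷_ (not-involutive x) (complement-involutive w)

take-complement : ∀ n w → take n (complement w) ≡ complement (take n w)
take-complement zero    w       = refl
take-complement (suc n) []      = refl
take-complement (suc n) (x ∷ w) = cong (not x ∷_) (take-complement n w)

drop-complement : ∀ n w → drop n (complement w) ≡ complement (drop n w)
drop-complement zero    w       = refl
drop-complement (suc n) []      = refl
drop-complement (suc n) (x ∷ w) = drop-complement n w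

dbl^ : ℕ → ℕ → ℕ
dbl^ zero    i = i
dbl^ (suc k) i = dbl^ k i + dbl^ k i

dbl^-* : ∀ k q → dbl^ k q ≡ q * dbl^ k 1
dbl^-* zero    q = sym (*-identityʳ q)
dbl^-* (suc k) q = trans (cong₂ _+_ (dbl^-* k q) (dbl^-* k q)) (sym (*-distribˡ-+ q (dbl^ k 1) (dbl^ k 1)))

dbl^-zero : ∀ k → dbl^ k 0 ≡ 0
dbl^-zero k = dbl^-* k 0

dbl^-two : ∀ k → dbl^ k 2 ≡ dbl^ k 1 + dbl^ k 1
dbl^-two k = trans (dbl^-* k 2) (cong (dbl^ k 1 +_) (+-identityʳ (dbl^ k 1)))

dbl^-grows : ∀ k j i → dbl^ k i ≤ dbl^ (k + j) i
dbl^-grows k zero    i = subst (λ z → dbl^ k i ≤ dbl^ z i) (sym (+-identityʳ k)) ≤-refl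
dbl^-grows k (suc j) i = subst (λ z → dbl^ k i ≤ dbl^ z i) (sym (+-suc k j)) (≤-trans (dbl^-grows k j i) (m≤m+n _ _))

n<2^n : ∀ n → n < dbl^ n 1
n<2^n zero    = s≤s z≤n
n<2^n (suc n) = +-mono-≤ (≤-trans (s≤s z≤n) (n<2^n n)) (n<2^n n)

length-μ : ∀ w → length (μ w) ≡ length w + length w
length-μ []      = refl
length-μ (x ∷ w) = cong suc (trans (cong suc (length-μ w)) (sym (+-suc (length w) (length w))))

length-μ^ : ∀ k w → length (μ^ k w) ≡ dbl^ k (length w)
length-μ^ zero    w = refl
length-μ^ (suc k) w = trans (length-μ (μ^ k w)) (cong₂ _+_ (length-μ^ k w) (length-μ^ k w))

nthOr-++ : ∀ d (u v : Word) i → i < length u → nthOr d (u ++ v) i ≡ nthOr d u i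
nthOr-++ d (x ∷ u) v zero    _       = refl
nthOr-++ d (x ∷ u) v (suc i) (s≤s p) = nthOr-++ d u v i p

nthOr-μ-even : ∀ d w i → nthOr d (μ w) (i + i) ≡ nthOr d w i
nthOr-μ-even d []      i       = refl
nthOr-μ-even d (x ∷ w) zero    = refl
nthOr-μ-even d (x ∷ w) (suc i) = trans (cong (nthOr d (not x ∷ μ w)) (+-suc i i)) (nthOr-μ-even d w i)

nthOr-μ-odd : ∀ d w i → i < length w → nthOr d (μ w) (suc (i + i)) ≡ not (nthOr d w i)
nthOr-μ-odd d (x ∷ w) zero    _       = refl
nthOr-μ-odd d (x ∷ w) (suc i) (s≤s p) = trans (cong (nthOr d (μ w)) (+-suc i i)) (nthOr-μ-odd d w i p)

tᵏ : ℕ → ℕ → Bool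
tᵏ k i = nthOr false (μ^ k (false ∷ [])) i

tᵏ-stable : ∀ k j i → i < dbl^ k 1 → tᵏ (k + j) i ≡ tᵏ k i
tᵏ-stable k zero    i p = cong (λ z → tᵏ z i) (+-identityʳ k)
tᵏ-stable k (suc j) i p = begin
  tᵏ (k + suc j) i
    ≡⟨ cong (λ z → tᵏ z i) (+-suc k j) ⟩
  tᵏ (suc (k + j)) i
    ≡⟨ cong (λ w → nthOr false w i) (μ^-μ (k + j) (false ∷ [])) ⟨
  nthOr false (μ^ (k + j) (μ (false ∷ []))) i
    ≡⟨ cong (λ w → nthOr false w i) (μ^-++ (k + j) (false ∷ []) (true ∷ [])) ⟩
  nthOr false (μ^ (k + j) (false ∷ []) ++ μ^ (k + j) (true ∷ [])) i
    ≡⟨ nthOr-++ false (μ^ (k + j) (false ∷ [])) _ i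
         (subst (i <_) (sym (length-μ^ (k + j) (false ∷ []))) (≤-trans p (dbl^-grows k j 1))) ⟩
  tᵏ (k + j) i
    ≡⟨ tᵏ-stable k j i p ⟩
  tᵏ k i ∎

t-prefix : ∀ k i → i < dbl^ k 1 → tᵏ k i ≡ t i
t-prefix k i p = begin
  tᵏ k i           ≡⟨ tᵏ-stable k (suc i) i p ⟨
  tᵏ (k + suc i) i ≡⟨ cong (λ z → tᵏ z i) (+-comm k (suc i)) ⟩
  tᵏ (suc i + k) i ≡⟨ tᵏ-stable (suc i) k i (<⇒≤ (n<2^n (suc i))) ⟩
  t i              ∎

t-even : ∀ i → t (i + i) ≡ t i
t-even i = trans (nthOr-μ-even false (μ^ (i + i) (false ∷ [])) i)
                 (t-prefix (i + i) i (≤-trans (n<2^n i) (dbl^-grows i i 1)))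

t-odd : ∀ i → t (suc (i + i)) ≡ not (t i)
t-odd i = trans (nthOr-μ-odd false (μ^ (suc (i + i)) (false ∷ [])) i i<length)
                (cong not (t-prefix (suc (i + i)) i i<2^))
  where
  i<2^ : i < dbl^ (suc (i + i)) 1
  i<2^ = subst (λ k → i < dbl^ k 1) (+-suc i i) (≤-trans (n<2^n i) (dbl^-grows i (suc i) 1))
  i<length : i < length (μ^ (suc (i + i)) (false ∷ []))
  i<length = subst (i <_) (sym (length-μ^ (suc (i + i)) (false ∷ []))) i<2^

seg : ℕ → ℕ → Word
seg i zero    = []
seg i (suc n) = t i ∷ seg (suc i) n

length-seg : ∀ i n → length (seg i n) ≡ n
length-seg i zero    = refl
length-seg i (suc n) = cong suc (length-seg (suc i) n)

applyUpTo-seg : ∀ (g : ℕ → Bool) i n → (∀ j → g j ≡ t (i + j)) → applyUpTo g n ≡ seg i n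
applyUpTo-seg g i zero    h = refl
applyUpTo-seg g i (suc n) h =
  cong₂ _∷_ (trans (h 0) (cong t (+-identityʳ i)))
            (applyUpTo-seg (λ j → g (suc j)) (suc i) n (λ j → trans (h (suc j)) (cong t (+-suc i j))))

slice≡seg : ∀ i n → slice i n ≡ seg i n
slice≡seg i n = trans (map-upTo (λ j → t (i + j)) n) (applyUpTo-seg _ i n (λ _ → refl))

seg-factor : ∀ i n → IsFactor (seg i n)
seg-factor i n = i , trans (sym (slice≡seg i n)) (cong (slice i) (sym (length-seg i n)))

factor-seg : ∀ w → IsFactor w → Σ ℕ λ i → w ≡ seg i (length w)
factor-seg w (i , e) = i , trans e (slice≡seg i (length w))

factor-seg-of-length : ∀ w → IsFactor w → ∀ {L} → length w ≡ L → Σ ℕ λ i → w ≡ seg i L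
factor-seg-of-length w fw refl = factor-seg w fw

seg-μ : ∀ i n → seg (i + i) (n + n) ≡ μ (seg i n)
seg-μ i zero    = refl
seg-μ i (suc n) = begin
  seg (i + i) (suc n + suc n)                    ≡⟨ cong (seg (i + i)) (cong suc (+-suc n n)) ⟩
  t (i + i) ∷ t (suc (i + i)) ∷ seg (suc (suc (i + i))) (n + n)
    ≡⟨ cong₂ (λ a b → a ∷ b ∷ seg (suc (suc (i + i))) (n + n)) (t-even i) (t-odd i) ⟩
  t i ∷ not (t i) ∷ seg (suc (suc (i + i))) (n + n)
    ≡⟨ cong (λ j → t i ∷ not (t i) ∷ seg j (n + n)) (sym (+-suc (suc i) i)) ⟩
  t i ∷ not (t i) ∷ seg (suc i + suc i) (n + n)  ≡⟨ cong (λ w → t i ∷ not (t i) ∷ w) (seg-μ (suc i) n) ⟩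
  μ (seg i (suc n))                              ∎

seg-μ^ : ∀ k i n → seg (dbl^ k i) (dbl^ k n) ≡ μ^ k (seg i n)
seg-μ^ zero    i n = refl
seg-μ^ (suc k) i n = trans (seg-μ (dbl^ k i) (dbl^ k n)) (cong μ (seg-μ^ k i n))

seg-take : ∀ i L M → L ≤ M → take L (seg i M) ≡ seg i L
seg-take i zero    M       _       = refl
seg-take i (suc L) (suc M) (s≤s p) = cong (t i ∷_) (seg-take (suc i) L M p)

seg-drop : ∀ i j n → drop j (seg i n) ≡ seg (i + j) (n ∸ j)
seg-drop i zero    n       = cong (λ k → seg k n) (sym (+-identityʳ i))
seg-drop i (suc j) zero    = refl
seg-drop i (suc j) (suc n) = trans (seg-drop (suc i) j n) (cong (λ k → seg k (n ∸ j)) (sym (+-suc i j)))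

seg-window : ∀ i r L M → r + L ≤ M → seg (i + r) L ≡ take L (drop r (seg i M))
seg-window i r L M p = begin
  seg (i + r) L               ≡⟨ seg-take (i + r) L (M ∸ r) (m+n≤o⇒m≤o∸n L (subst (_≤ M) (+-comm r L) p)) ⟨
  take L (seg (i + r) (M ∸ r)) ≡⟨ cong (take L) (seg-drop i r M) ⟨
  take L (drop r (seg i M))   ∎

seg-in-block : ∀ k q r L → r + L ≤ dbl^ k 2 → seg (dbl^ k q + r) L ≡ take L (drop r (μ^ k (t q ∷ t (suc q) ∷ [])))
seg-in-block k q r L p = trans (seg-window (dbl^ k q) r L (dbl^ k 2) p) (cong (λ w → take L (drop r w)) (seg-μ^ k q 2))

block-position : ∀ k i → Σ ℕ λ q → Σ ℕ λ r → r < dbl^ k 1 × i ≡ dbl^ k q + r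
block-position k i with dbl^ k 1 in eq | n<2^n k
... | suc d | _ = i / suc d , i % suc d , m%n<n i (suc d) , position
  where
  position : i ≡ dbl^ k (i / suc d) + i % suc d
  position = begin
    i                                   ≡⟨ m≡m%n+[m/n]*n i (suc d) ⟩
    i % suc d + i / suc d * suc d       ≡⟨ +-comm (i % suc d) _ ⟩
    i / suc d * suc d + i % suc d       ≡⟨ cong (λ b → i / suc d * b + i % suc d) eq ⟨
    i / suc d * dbl^ k 1 + i % suc d    ≡⟨ cong (_+ i % suc d) (dbl^-* k (i / suc d)) ⟨
    dbl^ k (i / suc d) + i % suc d      ∎

seg-as-window : ∀ k i L → L ≤ dbl^ k 1 → Σ ℕ λ q → Σ ℕ λ r →
  r < dbl^ k 1 × i ≡ dbl^ k q + r × seg i L ≡ take L (drop r (μ^ k (t q ∷ t (suc q) ∷ [])))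
seg-as-window k i L L≤ with block-position k i
... | q , r , r< , refl = q , r , r< , refl , seg-in-block k q r L fits
  where
  fits : r + L ≤ dbl^ k 2
  fits = subst (r + L ≤_) (sym (dbl^-two k)) (+-mono-≤ (<⇒≤ r<) L≤)

-- The set of factors of t is closed under complementation, since
-- t begins with μᵏ(0) μᵏ(1) and μᵏ(1) is the complement of μᵏ(0).
complement-seg : ∀ k i m → i + m ≤ dbl^ k 1 → complement (seg i m) ≡ seg (dbl^ k 1 + i) m
complement-seg k i m p = begin
  complement (seg i m)
    ≡⟨ cong (λ j → complement (seg (j + i) m)) (dbl^-zero k) ⟨
  complement (seg (dbl^ k 0 + i) m)
    ≡⟨ cong complement (in-block 0) ⟩
  complement (take m (drop i (μ^ k (false ∷ []))))
    ≡⟨ trans (cong (take m) (drop-complement i _)) (take-complement m _) ⟨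
  take m (drop i (complement (μ^ k (false ∷ []))))
    ≡⟨ cong (λ w → take m (drop i w)) (μ^-complement k (false ∷ [])) ⟨
  take m (drop i (μ^ k (true ∷ [])))
    ≡⟨ in-block 1 ⟨
  seg (dbl^ k 1 + i) m ∎
  where
  in-block : ∀ q → seg (dbl^ k q + i) m ≡ take m (drop i (μ^ k (t q ∷ [])))
  in-block q = trans (seg-window (dbl^ k q) i m (dbl^ k 1) p) (cong (λ w → take m (drop i w)) (seg-μ^ k q 1))

factor-complement : ∀ w → IsFactor w → IsFactor (complement w)
factor-complement w f with factor-seg w f
... | i , w≡ = subst IsFactor (sym complement-w) (seg-factor _ _)
  where
  k : ℕ
  k = i + length w
  complement-w : complement w ≡ seg (dbl^ k 1 + i) (length (complement w))
  complement-w = trans (cong complement w≡)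
    (trans (complement-seg k i (length w) (<⇒≤ (n<2^n k))) (cong (seg _) (sym (length-map not w))))

seg-prefix : ∀ i L V → IsPrefix V (seg i L) → V ≡ seg i (length V)
seg-prefix i L V p = trans (prefix-unique V _ _ p (take-prefix (length V) (seg i L)) (sym (length-take-≤ _ _ |V|≤)))
                           (seg-take i (length V) L (subst (length V ≤_) (length-seg i L) |V|≤))
  where
  |V|≤ : length V ≤ length (seg i L)
  |V|≤ = prefix-length V (seg i L) p

factor-prefix : ∀ v w → IsFactor w → IsPrefix v w → IsFactor v
factor-prefix v w f p with factor-seg w f
... | i , w≡ = subst IsFactor (sym (seg-prefix i (length w) v (subst (IsPrefix v) w≡ p))) (seg-factor i (length v))

seg-suffix : ∀ i L V → IsSuffix V (seg i L) → V ≡ seg (i + (L ∸ length V)) (length V)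
seg-suffix i L V (r , e) = begin
  V                                     ≡⟨ drop-length-++ r V ⟨
  drop (length r) (r ++ V)              ≡⟨ cong (drop (length r)) e ⟨
  drop (length r) (seg i L)             ≡⟨ seg-drop i (length r) L ⟩
  seg (i + length r) (L ∸ length r)
    ≡⟨ cong₂ (λ a b → seg (i + a) b) |r| (trans (cong (L ∸_) |r|) (m∸[m∸n]≡n |V|≤L)) ⟩
  seg (i + (L ∸ length V)) (length V)   ∎
  where
  |V|≤L : length V ≤ L
  |V|≤L = subst (length V ≤_) (length-seg i L) (suffix-length V _ (r , e))
  |r| : length r ≡ L ∸ length V
  |r| = trans (sym (m+n∸n≡m (length r) (length V)))
          (cong (_∸ length V) (trans (sym (length-++ r)) (trans (cong length (sym e)) (length-seg i L))))

-- Finite facts about short factors, checked by evaluation.  A factor of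
-- length L ≤ 16 at position i is a window of length L at some offset
-- r < 16, r ≡ i (mod 4), in one of the four blocks μ⁴(ab).
window : Bool → Bool → ℕ → ℕ → Word
window a b r L = take L (drop r (μ^ 4 (a ∷ b ∷ [])))

allPairs : (Bool → Bool → Bool) → Bool
allPairs f = f true true ∧ (f true false ∧ (f false true ∧ f false false))

allPairs-sound : ∀ f a b → T (allPairs f) → T (f a b)
allPairs-sound f a b h with T-∧⁻ {f true true} h
... | h₁ , r₁ with T-∧⁻ {f true false} r₁
... | h₂ , r₂ with T-∧⁻ {f false true} r₂
... | h₃ , h₄ = pick a b
  where
  pick : ∀ a b → T (f a b)
  pick true  true  = h₁
  pick true  false = h₂
  pick false true  = h₃
  pick false false = h₄

windowsAt : ℕ → (ℕ → Word → Bool) → ℕ → Bool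
windowsAt L p r = allPairs (λ a b → p (r % 4) (window a b r L))

allWindows : ℕ → (ℕ → Word → Bool) → Bool
allWindows L p = all< (windowsAt L p) 16

window-check : ∀ L p → L ≤ 16 → T (allWindows L p) → ∀ i → T (p (i % 4) (seg i L))
window-check L p L≤16 h i with seg-as-window 4 i L L≤16
... | q , r , r<16 , refl , seg≡ =
  subst (λ w → T (p _ w)) (sym seg≡)
    (subst (λ s → T (p s (window (t q) (t (suc q)) r L))) (sym residue)
      (allPairs-sound (λ a b → p (r % 4) (window a b r L)) (t q) (t (suc q)) (all<-sound (windowsAt L p) 16 h r r<16)))
  where
  residue : (dbl^ 4 q + r) % 4 ≡ r % 4
  residue = begin
    (dbl^ 4 q + r) % 4  ≡⟨ cong (_% 4) (trans (+-comm (dbl^ 4 q) r) (cong (r +_) (trans (dbl^-* 4 q) (sym (*-assoc q 4 4))))) ⟩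
    (r + q * 4 * 4) % 4 ≡⟨ [m+kn]%n≡m%n r (q * 4) 4 ⟩
    r % 4               ∎

Admissible : ℕ → ℕ → Set
Admissible s ℓ = (s ≡ 2 × ℓ ≡ 0) ⊎ (s ≡ 3 × ℓ ≡ 2)

PositionClass : ℕ → ℕ → Set
PositionClass i L = Admissible (i % 4) (L % 4)

admissibleB : ℕ → ℕ → Bool
admissibleB s ℓ = ((s ≡ᵇ 2) ∧ (ℓ ≡ᵇ 0)) ∨ ((s ≡ᵇ 3) ∧ (ℓ ≡ᵇ 2))

admissibleB-sound : ∀ s ℓ → T (admissibleB s ℓ) → Admissible s ℓ
admissibleB-sound s ℓ h with to (T-∨ {(s ≡ᵇ 2) ∧ (ℓ ≡ᵇ 0)}) h
... | inj₁ h₂ = let (a , b) = T-∧⁻ {s ≡ᵇ 2} h₂ in inj₁ (≡ᵇ⇒≡ s 2 a , ≡ᵇ⇒≡ ℓ 0 b)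
... | inj₂ h₃ = let (a , b) = T-∧⁻ {s ≡ᵇ 3} h₃ in inj₂ (≡ᵇ⇒≡ s 3 a , ≡ᵇ⇒≡ ℓ 2 b)

classB : ℕ → ℕ → Word → Bool
classB L s w = (isPrefixB w010 w ∧ privB w) ⇒ᵇ admissibleB s (L % 4)

classRow : ℕ → Bool
classRow L = (4 ≤ᵇ L) ⇒ᵇ allWindows L (classB L)

class-checked : T (all< classRow 15)
class-checked = _

class-small : ∀ i L → 4 ≤ L → L ≤ 14 → Privileged (seg i L) → IsPrefix w010 (seg i L) → PositionClass i L
class-small i L 4≤L L≤14 priv pre =
  admissibleB-sound (i % 4) (L % 4)
    (⇒ᵇ-mp (window-check L (classB L) (≤-trans L≤14 (≤ᵇ⇒≤ 14 16 _))
              (⇒ᵇ-mp (all<-sound classRow 15 class-checked L (s≤s L≤14)) (≤⇒≤ᵇ 4≤L)) i)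
           (T-∧⁺ (isPrefixB-complete w010 _ pre) (privB-complete _ priv)))

w010-recurs : ∀ i → IsPrefix w010 (seg i 12) → 2 ≤ occ w010 (seg i 12)
w010-recurs i pre = ≤ᵇ⇒≤ 2 _ (⇒ᵇ-mp (window-check 12 recursB (≤ᵇ⇒≤ 12 16 _) _ i) (isPrefixB-complete w010 _ pre))
  where
  recursB : ℕ → Word → Bool
  recursB _ w = isPrefixB w010 w ⇒ᵇ (2 ≤ᵇ occ w010 w)

zeros-in-7 : ∀ i → 3 ≤ occ (false ∷ []) (seg i 7)
zeros-in-7 i = ≤ᵇ⇒≤ 3 _ (window-check 7 (λ _ w → 3 ≤ᵇ occ (false ∷ []) w) (≤ᵇ⇒≤ 7 16 _) _ i)

no-111 : ∀ i → seg i 3 ≢ true ∷ true ∷ true ∷ []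
no-111 i e = subst (λ w → T (not (isPrefixB w111 w))) e (window-check 3 (λ _ w → not (isPrefixB w111 w)) (≤ᵇ⇒≤ 3 16 _) _ i)
  where
  w111 : Word
  w111 = true ∷ true ∷ true ∷ []

occ-[] : ∀ w → occ [] w ≡ suc (length w)
occ-[] []      = refl
occ-[] (x ∷ w) = cong suc (occ-[] w)

bit : Bool → ℕ
bit b = if b then 1 else 0

bit-mono : ∀ {b₁ b₂} → (T b₁ → T b₂) → bit b₁ ≤ bit b₂
bit-mono {true}  {true}  _ = ≤-refl
bit-mono {true}  {false} f = ⊥-elim (f _)
bit-mono {false}         _ = z≤n

isPrefixB-take : ∀ v m w → T (isPrefixB v (take m w)) → T (isPrefixB v w)
isPrefixB-take []      m       w       _ = _
isPrefixB-take (a ∷ v) (suc m) (x ∷ w) h with T-∧⁻ {a ==b x} h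
... | ha , hv = T-∧⁺ ha (isPrefixB-take v m w hv)

occ-split : ∀ a v m w → occ (a ∷ v) (take m w) + occ (a ∷ v) (drop m w) ≤ occ (a ∷ v) w
occ-split a v zero    w       = ≤-refl
occ-split a v (suc m) []      = z≤n
occ-split a v (suc m) (x ∷ w) =
  subst (_≤ occ (a ∷ v) (x ∷ w)) (sym (+-assoc (bit (isPrefixB (a ∷ v) (x ∷ take m w))) _ _))
    (+-mono-≤ (bit-mono (isPrefixB-take (a ∷ v) (suc m) (x ∷ w))) (occ-split a v m w))

occ-++ˡ : ∀ a v r u → occ (a ∷ v) u ≤ occ (a ∷ v) (r ++ u)
occ-++ˡ a v []      u = ≤-refl
occ-++ˡ a v (x ∷ r) u = ≤-trans (occ-++ˡ a v r u) (m≤n+m _ _)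

occ-suffix : ∀ a v u → IsSuffix (a ∷ v) u → 1 ≤ occ (a ∷ v) u
occ-suffix a v .(r ++ a ∷ v) (r , refl) = ≤-trans self (occ-++ˡ a v r (a ∷ v))
  where
  self : 1 ≤ occ (a ∷ v) (a ∷ v)
  self = ≤-trans (bit-mono {true} (λ _ → isPrefixB-complete (a ∷ v) (a ∷ v) (prefix-refl (a ∷ v)))) (m≤m+n _ _)

suffix-drop : ∀ (v w : Word) m → m + length v ≤ length w → IsSuffix v w → IsSuffix v (drop m w)
suffix-drop v .(r ++ v) m le (r , refl) = drop m r , drop-++ m r le
  where
  drop-++ : ∀ m r → m + length v ≤ length (r ++ v) → drop m (r ++ v) ≡ drop m r ++ v
  drop-++ zero    r       _        = refl
  drop-++ (suc m) []      le′      = ⊥-elim (<-irrefl refl (≤-trans (s≤s (m≤n+m (length v) m)) le′))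
  drop-++ (suc m) (x ∷ r) (s≤s le′) = drop-++ m r le′

return-of : ∀ w → Privileged w → 2 ≤ length w →
  Σ Word λ v → Privileged v × length v < length w × CompleteFirstReturn v w
return-of w (priv-return {v} pv lt cfr) _ = v , pv , lt , cfr
return-of .(a ∷ []) (priv-letter a) (s≤s ())

w01-not-privileged : ¬ Privileged w01
w01-not-privileged p = privB-complete w01 p

-- A factor of length ≥ 7 beginning with 01 is not a complete first return
-- to a privileged word of length < 3: the empty word and 0 occur too often
-- (every factor of length 7 has three 0s) and 01 is not privileged.
long-return : ∀ i L V → 7 ≤ L → IsPrefix w01 (seg i L) → Privileged V →
  CompleteFirstReturn V (seg i L) → 3 ≤ length V
long-return i L [] 7≤L _ _ (_ , _ , occ≡2) = ⊥-elim (7≰1 (subst (7 ≤_) |W|≡1 7≤L))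
  where
  |W|≡1 : L ≡ 1
  |W|≡1 = trans (sym (length-seg i L)) (suc-injective (trans (sym (occ-[] (seg i L))) occ≡2))
  7≰1 : ¬ 7 ≤ 1
  7≰1 (s≤s ())
long-return i L (a ∷ []) 7≤L pre01 _ (preV , _ , occ≡2) with prefix-of-prefix (a ∷ []) w01 (seg i L) preV pre01 (s≤s z≤n)
... | _ , refl = ⊥-elim (3≰2 (subst (3 ≤_) occ≡2 (≤-trans (zeros-in-7 i) zeros-in-W)))
  where
  zeros-in-W : occ (false ∷ []) (seg i 7) ≤ occ (false ∷ []) (seg i L)
  zeros-in-W = subst (λ w → occ (false ∷ []) w ≤ occ (false ∷ []) (seg i L)) (seg-take i 7 L 7≤L)
                 (≤-trans (m≤m+n _ _) (occ-split false [] 7 (seg i L)))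
  3≰2 : ¬ 3 ≤ 2
  3≰2 (s≤s (s≤s ()))
long-return i L (a ∷ b ∷ []) 7≤L pre01 privV (preV , _ , _) with prefix-of-prefix w01 (a ∷ b ∷ []) (seg i L) pre01 preV ≤-refl
... | [] , refl = ⊥-elim (w01-not-privileged privV)
long-return i L (a ∷ b ∷ c ∷ V) _ _ _ _ = s≤s (s≤s (s≤s z≤n))

-- A privileged factor of length ≥ 15 beginning with 010 is a complete first
-- return to a privileged word of length ≥ 5 beginning with 010: returns of
-- length < 3 are excluded as above, 010 occurs at least three times (twice in
-- the first 12 letters and once as a suffix), and 010x is not privileged.
long-return-010 : ∀ i L V → 15 ≤ L → IsPrefix w010 (seg i L) → Privileged V →
  CompleteFirstReturn V (seg i L) → 5 ≤ length V × IsPrefix w010 V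
long-return-010 i L V 15≤L pre010 privV cfr
  with prefix-of-prefix w010 V (seg i L) pre010 (proj₁ cfr)
         (long-return i L V (≤-trans (m≤n+m 7 8) 15≤L) (prefix-trans (false ∷ [] , refl) pre010) privV cfr)
... | r , refl = extend r privV cfr
  where
  W : Word
  W = seg i L
  3≰2 : ¬ 3 ≤ 2
  3≰2 (s≤s (s≤s ()))
  12≤L : 12 ≤ L
  12≤L = ≤-trans (m≤m+n 12 3) 15≤L
  twice-in-prefix : 2 ≤ occ w010 (take 12 W)
  twice-in-prefix = subst (λ w → 2 ≤ occ w010 w) (sym (seg-take i 12 L 12≤L))
    (w010-recurs i (subst (IsPrefix w010) (seg-take i 12 L 12≤L)
      (prefix-of-prefix w010 (take 12 W) W pre010 (take-prefix 12 W)
        (subst (3 ≤_) (sym (trans (cong length (seg-take i 12 L 12≤L)) (length-seg i 12))) (s≤s (s≤s (s≤s z≤n)))))))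
  extend : ∀ r → Privileged (w010 ++ r) → CompleteFirstReturn (w010 ++ r) W →
    5 ≤ length (w010 ++ r) × IsPrefix w010 (w010 ++ r)
  extend [] _ (_ , suf , occ≡2) = ⊥-elim (3≰2 (subst (3 ≤_) occ≡2 three-occurrences))
    where
    once-in-rest : 1 ≤ occ w010 (drop 12 W)
    once-in-rest = occ-suffix false (true ∷ false ∷ []) _ (suffix-drop w010 W 12 (subst (15 ≤_) (sym (length-seg i L)) 15≤L) suf)
    three-occurrences : 3 ≤ occ w010 W
    three-occurrences = ≤-trans (+-mono-≤ twice-in-prefix once-in-rest) (occ-split false (true ∷ false ∷ []) 12 W)
  extend (true  ∷ []) p _ = ⊥-elim (privB-complete _ p)
  extend (false ∷ []) p _ = ⊥-elim (privB-complete _ p)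
  extend (x ∷ y ∷ r) _ _ = s≤s (s≤s (s≤s (s≤s (s≤s z≤n)))) , (x ∷ y ∷ r , refl)

admissible-start : ∀ {s s′ ℓ} → Admissible s ℓ → Admissible s′ ℓ → s ≡ s′
admissible-start (inj₁ (a , _)) (inj₁ (b , _)) = trans a (sym b)
admissible-start (inj₂ (a , _)) (inj₂ (b , _)) = trans a (sym b)
admissible-start (inj₁ (_ , a)) (inj₂ (_ , b)) with trans (sym a) b
... | ()
admissible-start (inj₂ (_ , a)) (inj₁ (_ , b)) with trans (sym a) b
... | ()

admissible-length : ∀ {s ℓ ℓ′} → Admissible s ℓ → Admissible s ℓ′ → ℓ ≡ ℓ′
admissible-length (inj₁ (_ , a)) (inj₁ (_ , b)) = trans a (sym b)
admissible-length (inj₂ (_ , a)) (inj₂ (_ , b)) = trans a (sym b)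
admissible-length (inj₁ (a , _)) (inj₂ (b , _)) with trans (sym a) b
... | ()
admissible-length (inj₂ (a , _)) (inj₁ (b , _)) with trans (sym a) b
... | ()

mod4-cancel : ∀ a b → a < 4 → b < 4 → (a + b) % 4 ≡ a → b ≡ 0
mod4-cancel a zero _ _ _ = refl
mod4-cancel 0 1 _ _ ()
mod4-cancel 0 2 _ _ ()
mod4-cancel 0 3 _ _ ()
mod4-cancel 1 1 _ _ ()
mod4-cancel 1 2 _ _ ()
mod4-cancel 1 3 _ _ ()
mod4-cancel 2 1 _ _ ()
mod4-cancel 2 2 _ _ ()
mod4-cancel 2 3 _ _ ()
mod4-cancel 3 1 _ _ ()
mod4-cancel 3 2 _ _ ()
mod4-cancel 3 3 _ _ ()
mod4-cancel (suc (suc (suc (suc _)))) _ (s≤s (s≤s (s≤s (s≤s ())))) _ _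
mod4-cancel _ (suc (suc (suc (suc _)))) _ (s≤s (s≤s (s≤s (s≤s ())))) _

-- Two occurrences of a word with the same position class at positions i and
-- i + d force d ≡ 0 (mod 4), so the class extends to the length v + d.
class-combine : ∀ i v d → PositionClass i v → PositionClass (i + d) v → PositionClass i (v + d)
class-combine i v d at-i at-i+d = subst (Admissible (i % 4)) (sym length-residue) at-i
  where
  d%4≡0 : d % 4 ≡ 0
  d%4≡0 = mod4-cancel (i % 4) (d % 4) (m%n<n i 4) (m%n<n d 4)
            (trans (sym (%-distribˡ-+ i d 4)) (sym (admissible-start at-i at-i+d)))
  length-residue : (v + d) % 4 ≡ v % 4
  length-residue = begin
    (v + d) % 4          ≡⟨ %-distribˡ-+ v d 4 ⟩
    (v % 4 + d % 4) % 4  ≡⟨ cong (λ x → (v % 4 + x) % 4) d%4≡0 ⟩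
    (v % 4 + 0) % 4      ≡⟨ cong (_% 4) (+-identityʳ (v % 4)) ⟩
    v % 4 % 4            ≡⟨ m%n%n≡m%n v 4 ⟩
    v % 4                ∎

-- For L ≥ 15 it is
-- a complete first return to a privileged V of length ≥ 5 beginning with 010,
-- which occurs at positions i and i + (L - |V|); induction on the length.
ClassStatement : ℕ → Set
ClassStatement L = ∀ i → 4 ≤ L → Privileged (seg i L) → IsPrefix w010 (seg i L) → PositionClass i L

position-class : ∀ L → ClassStatement L
position-class = <-rec ClassStatement step
  where
  step : ∀ L → (∀ {K} → K < L → ClassStatement K) → ClassStatement L
  step L rec i 4≤L priv pre with L ≤? 14
  ... | yes L≤14 = class-small i L 4≤L L≤14 priv pre
  ... | no  L≰14 = subst (PositionClass i) (m+[n∸m]≡n (<⇒≤ |V|<L)) (class-combine i |V| (L ∸ |V|) at-start at-end)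
    where
    W : Word
    W = seg i L
    15≤L : 15 ≤ L
    15≤L = ≰⇒> L≰14
    return : Σ Word λ v → Privileged v × length v < length W × CompleteFirstReturn v W
    return = return-of W priv (subst (2 ≤_) (sym (length-seg i L)) (≤-trans (s≤s (s≤s z≤n)) 4≤L))
    V : Word
    V = proj₁ return
    privV : Privileged V
    privV = proj₁ (proj₂ return)
    cfr : CompleteFirstReturn V W
    cfr = proj₂ (proj₂ (proj₂ return))
    |V| : ℕ
    |V| = length V
    |V|<L : |V| < L
    |V|<L = subst (|V| <_) (length-seg i L) (proj₁ (proj₂ (proj₂ return)))
    shape : 5 ≤ |V| × IsPrefix w010 V
    shape = long-return-010 i L V 15≤L pre privV cfr
    4≤|V| : 4 ≤ |V|
    4≤|V| = ≤-trans (m≤n+m 4 1) (proj₁ shape)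
    class-at : ∀ j → V ≡ seg j |V| → PositionClass j |V|
    class-at j V≡ = rec |V|<L j 4≤|V| (subst Privileged V≡ privV) (subst (IsPrefix w010) V≡ (proj₂ shape))
    at-start : PositionClass i |V|
    at-start = class-at i (seg-prefix i L V (proj₁ cfr))
    at-end : PositionClass (i + (L ∸ |V|)) |V|
    at-end = class-at (i + (L ∸ |V|)) (seg-suffix i L V (proj₁ (proj₂ cfr)))

Eligible : Word → Set
Eligible y = IsFactor y × IsPrefix w01 y × 2 ≤ length y

eligible-prefix : ∀ v y → Eligible y → IsPrefix v y → 2 ≤ length v → Eligible v
eligible-prefix v y (fy , pre01 , _) p 2≤|v| = factor-prefix v y fy p , prefix-of-prefix w01 v y pre01 p 2≤|v| , 2≤|v|

return-shape : ∀ v y → Eligible y → 7 ≤ length y → Privileged v → CompleteFirstReturn v y →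
  Σ Bool λ a → Σ Word λ v′ → v ≡ false ∷ true ∷ a ∷ v′
return-shape v y (fy , pre01 , _) 7≤|y| privV cfr =
  prefix01-long v (prefix-of-prefix w01 v y pre01 (proj₁ cfr) (≤-trans (m≤n+m 2 1) 3≤|v|)) 3≤|v|
  where
  i : ℕ
  i = proj₁ (factor-seg y fy)
  y≡ : y ≡ seg i (length y)
  y≡ = proj₂ (factor-seg y fy)
  3≤|v| : 3 ≤ length v
  3≤|v| = long-return i (length y) v 7≤|y| (subst (IsPrefix w01) y≡ pre01) privV (subst (CompleteFirstReturn v) y≡ cfr)

eligible-return : ∀ y → Eligible y → 7 ≤ length y → Privileged y →
  Σ Bool λ a → Σ Word λ v′ → Privileged (false ∷ true ∷ a ∷ v′) ×
    length (false ∷ true ∷ a ∷ v′) < length y × CompleteFirstReturn (false ∷ true ∷ a ∷ v′) y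
eligible-return y el 7≤|y| privY with return-of y privY (proj₂ (proj₂ el))
... | v , privV , |v|<|y| , cfr with return-shape v y el 7≤|y| privV cfr
... | a , v′ , refl = a , v′ , privV , |v|<|y| , cfr

transferB : (Word → Word) → ℕ → Word → Bool
transferB code _ w = isPrefixB w01 w ⇒ᵇ (privB w ==b privB (code w))

transferRow : (Word → Word) → ℕ → Bool
transferRow code m = (2 ≤ᵇ m) ⇒ᵇ allWindows m (transferB code)

small-cases-by-check : ∀ code → T (all< (transferRow code) 7) →
  ∀ i m → 2 ≤ m → m ≤ 6 → IsPrefix w01 (seg i m) → privB (seg i m) ≡ privB (code (seg i m))
small-cases-by-check code checked i m 2≤m m≤6 pre01 =
  ==b-sound (privB (seg i m)) (privB (code (seg i m))) (⇒ᵇ-mp (window-check m (transferB code) (≤-trans m≤6 (≤ᵇ⇒≤ 6 16 _))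
                        (⇒ᵇ-mp (all<-sound (transferRow code) 7 checked m (s≤s m≤6)) (≤⇒≤ᵇ 2≤m)) i)
                      (isPrefixB-complete w01 _ pre01))

-- A coding sends a word y of length m ≥ 2 beginning with 01 to a word of
-- length codeLength m beginning with 010, compatibly with prefixes,
-- suffixes and occurrence counts, and sends the factors of t of length m
-- onto the factors of length codeLength m at positions ≡ startResidue (mod 4).
record Coding : Set where
  field
    code               : Word → Word
    codeLength         : ℕ → ℕ
    length-code        : ∀ y → 2 ≤ length y → length (code y) ≡ codeLength (length y)
    codeLength-mono    : ∀ {a b} → 2 ≤ a → a < b → codeLength a < codeLength b
    codeLength-cancel  : ∀ {a b} → codeLength a < codeLength b → a < b
    codeLength-large   : ∀ {m} → 7 ≤ m → 15 ≤ codeLength m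
    codeLength-≥4      : ∀ {m} → 3 ≤ m → 4 ≤ codeLength m
    startResidue       : ℕ
    lengthResidue      : ℕ
    residues           : Admissible startResidue lengthResidue
    codeLength-residue : ∀ m → codeLength m % 4 ≡ lengthResidue
    codeLength-onto    : ∀ ℓ → 5 ≤ ℓ → ℓ % 4 ≡ lengthResidue → Σ ℕ λ k → 3 ≤ k × ℓ ≡ codeLength k
    isPrefixB-code     : ∀ a b v x → isPrefixB (code (a ∷ b ∷ v)) (code x) ≡ isPrefixB (a ∷ b ∷ v) x
    occ-code           : ∀ a v x → occ (code (false ∷ true ∷ a ∷ v)) (code x) ≡ occ (false ∷ true ∷ a ∷ v) x
    code-suffix        : ∀ r a b w → IsSuffix (code (a ∷ b ∷ w)) (code (r ++ a ∷ b ∷ w))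
    code-prefix010     : ∀ y → 3 ≤ length y → IsPrefix w01 y → IsPrefix w010 (code y)
    code-prefix01⁻     : ∀ y → 3 ≤ length y → IsPrefix w010 (code y) → IsPrefix w01 y
    image              : ∀ i m → 2 ≤ m → Σ ℕ λ j → j % 4 ≡ startResidue × code (seg i m) ≡ seg j (codeLength m)
    preimage           : ∀ j m → 2 ≤ m → j % 4 ≡ startResidue →
                           Σ Word λ y → IsFactor y × length y ≡ m × seg j (codeLength m) ≡ code y
    small-cases        : ∀ i m → 2 ≤ m → m ≤ 6 → IsPrefix w01 (seg i m) → privB (seg i m) ≡ privB (code (seg i m))

module CodingProperties (𝒞 : Coding) where
  open Coding 𝒞

  code-prefix⁺ : ∀ v x → 2 ≤ length v → IsPrefix v x → IsPrefix (code v) (code x)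
  code-prefix⁺ (a ∷ b ∷ v) x _ p =
    isPrefixB-sound _ _ (subst T (sym (isPrefixB-code a b v x)) (isPrefixB-complete _ _ p))
  code-prefix⁺ (a ∷ []) x (s≤s ()) _

  code-prefix⁻ : ∀ v x → 2 ≤ length v → IsPrefix (code v) (code x) → IsPrefix v x
  code-prefix⁻ (a ∷ b ∷ v) x _ p =
    isPrefixB-sound _ _ (subst T (isPrefixB-code a b v x) (isPrefixB-complete _ _ p))
  code-prefix⁻ (a ∷ []) x (s≤s ()) _

  code-injective : ∀ u v → 2 ≤ length u → length u ≡ length v → code u ≡ code v → u ≡ v
  code-injective u v 2≤|u| |u|≡|v| e =
    prefix-unique u v v (code-prefix⁻ u v 2≤|u| (subst (λ w → IsPrefix w (code v)) (sym e) (prefix-refl (code v))))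
                  (prefix-refl v) |u|≡|v|

  code-suffix⁺ : ∀ a b v x → IsSuffix (a ∷ b ∷ v) x → IsSuffix (code (a ∷ b ∷ v)) (code x)
  code-suffix⁺ a b v .(r ++ a ∷ b ∷ v) (r , refl) = code-suffix r a b v

  -- Split x as x₁ ++ x₂ with |x₂| = |u|; the codes of x₂ and u are suffixes
  -- of code x of equal length, so x₂ = u by injectivity.
  code-suffix⁻ : ∀ a b v x → length (a ∷ b ∷ v) ≤ length x →
    IsSuffix (code (a ∷ b ∷ v)) (code x) → IsSuffix (a ∷ b ∷ v) x
  code-suffix⁻ a b v x |u|≤|x| (s , code-x) = x₁ , trans (sym (take++drop≡id n x)) (cong (x₁ ++_) x₂≡u)
    where
    u : Word
    u = a ∷ b ∷ v
    n : ℕ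
    n = length x ∸ length u
    x₁ : Word
    x₁ = take n x
    x₂ : Word
    x₂ = drop n x
    |x₂|≡|u| : length x₂ ≡ length u
    |x₂|≡|u| = trans (length-drop n x) (m∸[m∸n]≡n |u|≤|x|)
    x₂≡u : x₂ ≡ u
    x₂≡u with x₂ | |x₂|≡|u| | take++drop≡id n x
    ... | c ∷ d ∷ w | |x₂|≡ | x≡ = code-injective (c ∷ d ∷ w) u (s≤s (s≤s z≤n)) |x₂|≡
      (sym (proj₂ (++-split-eqʳ s (code u) (proj₁ (code-suffix x₁ c d w)) (code (c ∷ d ∷ w))
        (trans (sym code-x) (trans (cong code (sym x≡)) (proj₂ (code-suffix x₁ c d w))))
        (trans (length-code u (s≤s (s≤s z≤n)))
          (trans (cong codeLength (sym |x₂|≡)) (sym (length-code (c ∷ d ∷ w) (s≤s (s≤s z≤n)))))))))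

  code-cfr⁺ : ∀ a v x → CompleteFirstReturn (false ∷ true ∷ a ∷ v) x →
    CompleteFirstReturn (code (false ∷ true ∷ a ∷ v)) (code x)
  code-cfr⁺ a v x (pre , suf , occ≡2) =
    code-prefix⁺ _ x (s≤s (s≤s z≤n)) pre , code-suffix⁺ false true (a ∷ v) x suf , trans (occ-code a v x) occ≡2

  code-cfr⁻ : ∀ a v x → length (false ∷ true ∷ a ∷ v) ≤ length x →
    CompleteFirstReturn (code (false ∷ true ∷ a ∷ v)) (code x) → CompleteFirstReturn (false ∷ true ∷ a ∷ v) x
  code-cfr⁻ a v x |u|≤|x| (pre , suf , occ≡2) =
    code-prefix⁻ _ x (s≤s (s≤s z≤n)) pre , code-suffix⁻ false true (a ∷ v) x |u|≤|x| suf ,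
    trans (sym (occ-code a v x)) occ≡2

  small-transfer : ∀ y → Eligible y → length y ≤ 6 → privB y ≡ privB (code y)
  small-transfer y (fy , pre01 , 2≤|y|) |y|≤6 with factor-seg y fy
  ... | i , y≡ = subst (λ w → privB w ≡ privB (code w)) (sym y≡)
                   (small-cases i (length y) 2≤|y| |y|≤6 (subst (IsPrefix w01) y≡ pre01))

  small⁺ : ∀ y → Eligible y → length y ≤ 6 → Privileged y → Privileged (code y)
  small⁺ y el |y|≤6 privY = privB-sound (code y) (subst T (small-transfer y el |y|≤6) (privB-complete y privY))

  small⁻ : ∀ y → Eligible y → length y ≤ 6 → Privileged (code y) → Privileged y
  small⁻ y el |y|≤6 privW = privB-sound y (subst T (sym (small-transfer y el |y|≤6)) (privB-complete (code y) privW))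

  PrivilegedPreserved : ℕ → Set
  PrivilegedPreserved m = ∀ y → length y ≡ m → Eligible y → Privileged y → Privileged (code y)

  -- Induction on |y|, the base |y| ≤ 6 by evaluation: a long eligible y
  -- returns to a privileged v = 01av′ (eligible-return), so code y returns to
  -- the privileged code v.
  privileged⁺ : ∀ m → PrivilegedPreserved m
  privileged⁺ = <-rec PrivilegedPreserved step
    where
    step : ∀ m → (∀ {k} → k < m → PrivilegedPreserved k) → PrivilegedPreserved m
    step m rec y refl el@(_ , _ , 2≤|y|) privY with length y ≤? 6
    ... | yes |y|≤6 = small⁺ y el |y|≤6 privY
    ... | no  |y|≰6 with eligible-return y el (≰⇒> |y|≰6) privY
    ... | a , v′ , privV , |v|<|y| , cfr =
      priv-return (rec |v|<|y| v refl (eligible-prefix v y el (proj₁ cfr) (s≤s (s≤s z≤n))) privV)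
        (subst₂ _<_ (sym (length-code v (s≤s (s≤s z≤n)))) (sym (length-code y 2≤|y|))
                    (codeLength-mono (s≤s (s≤s z≤n)) |v|<|y|))
        (code-cfr⁺ a v′ y cfr)
      where
      v : Word
      v = false ∷ true ∷ a ∷ v′

  -- If code y (y eligible, |y| ≥ 7) is a privileged factor at position j, its
  -- return V begins with 010 and has length ≥ 5, and V also sits at position
  -- j ≡ startResidue; by the position-class theorem |V| ≡ lengthResidue, so
  -- |V| = codeLength k with 3 ≤ k < |y|.
  return-length : ∀ y j V → IsPrefix w01 y → 7 ≤ length y → j % 4 ≡ startResidue →
    code y ≡ seg j (codeLength (length y)) → Privileged V → length V < length (code y) →
    CompleteFirstReturn V (code y) → Σ ℕ λ k → 3 ≤ k × k < length y × length V ≡ codeLength k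
  return-length y j V pre01 7≤|y| j%4≡ W≡ privV |V|<|W| cfrV = k , 3≤k , k<|y| , |V|≡
    where
    2≤|y| : 2 ≤ length y
    2≤|y| = ≤-trans (m≤n+m 2 5) 7≤|y|
    L : ℕ
    L = codeLength (length y)
    pre010 : IsPrefix w010 (seg j L)
    pre010 = subst (IsPrefix w010) W≡ (code-prefix010 y (≤-trans (m≤n+m 3 4) 7≤|y|) pre01)
    shape : 5 ≤ length V × IsPrefix w010 V
    shape = long-return-010 j L V (codeLength-large 7≤|y|) pre010 privV (subst (CompleteFirstReturn V) W≡ cfrV)
    V≡seg : V ≡ seg j (length V)
    V≡seg = seg-prefix j L V (subst (IsPrefix V) W≡ (proj₁ cfrV))
    class : PositionClass j (length V)
    class = position-class (length V) j (≤-trans (m≤n+m 4 1) (proj₁ shape))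
              (subst Privileged V≡seg privV) (subst (IsPrefix w010) V≡seg (proj₂ shape))
    onto : Σ ℕ λ k → 3 ≤ k × length V ≡ codeLength k
    onto = codeLength-onto (length V) (proj₁ shape)
             (admissible-length (subst (λ s → Admissible s (length V % 4)) j%4≡ class) residues)
    k : ℕ
    k = proj₁ onto
    3≤k : 3 ≤ k
    3≤k = proj₁ (proj₂ onto)
    |V|≡ : length V ≡ codeLength k
    |V|≡ = proj₂ (proj₂ onto)
    k<|y| : k < length y
    k<|y| = codeLength-cancel (subst₂ _<_ |V|≡ (length-code y 2≤|y|) |V|<|W|)

  CodeReturn : Word → Set
  CodeReturn y = Σ Word λ v → Privileged (code v) × IsPrefix v y × 3 ≤ length v × length v < length y ×
    CompleteFirstReturn (code v) (code y)

  code-return : ∀ y → Eligible y → 7 ≤ length y → Privileged (code y) → CodeReturn y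
  code-return y (fy , pre01 , 2≤|y|) 7≤|y| privW with factor-seg y fy
  ... | i , y≡ with image i (length y) 2≤|y|
  ... | j , j%4≡ , img
      with return-of (code y) privW (subst (2 ≤_) (sym (length-code y 2≤|y|)) (≤-trans (s≤s (s≤s z≤n)) 15≤L))
    where
    15≤L : 15 ≤ codeLength (length y)
    15≤L = codeLength-large 7≤|y|
  ... | V , privV , |V|<|W| , cfrV with return-length y j V pre01 7≤|y| j%4≡ (trans (cong code y≡) img) privV |V|<|W| cfrV
  ... | k , 3≤k , k<|y| , |V|≡ = v , subst Privileged V≡code-v privV , take-prefix k y , 3≤|v| , |v|<|y| ,
                                 subst (λ U → CompleteFirstReturn U (code y)) V≡code-v cfrV
    where
    v : Word
    v = take k y
    |v|≡k : length v ≡ k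
    |v|≡k = length-take-≤ k y (<⇒≤ k<|y|)
    3≤|v| : 3 ≤ length v
    3≤|v| = subst (3 ≤_) (sym |v|≡k) 3≤k
    |v|<|y| : length v < length y
    |v|<|y| = subst (_< length y) (sym |v|≡k) k<|y|
    2≤|v| : 2 ≤ length v
    2≤|v| = ≤-trans (m≤n+m 2 1) 3≤|v|
    V≡code-v : V ≡ code v
    V≡code-v = prefix-unique V (code v) (code y) (proj₁ cfrV) (code-prefix⁺ v y 2≤|v| (take-prefix k y))
                 (trans |V|≡ (trans (cong codeLength (sym |v|≡k)) (sym (length-code v 2≤|v|))))

  PrivilegedReflected : ℕ → Set
  PrivilegedReflected m = ∀ y → length y ≡ m → Eligible y → Privileged (code y) → Privileged y

  privileged⁻ : ∀ m → PrivilegedReflected m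
  privileged⁻ = <-rec PrivilegedReflected step
    where
    step : ∀ m → (∀ {k} → k < m → PrivilegedReflected k) → PrivilegedReflected m
    step m rec y refl el@(_ , pre01 , _) privW with length y ≤? 6
    ... | yes |y|≤6 = small⁻ y el |y|≤6 privW
    ... | no  |y|≰6 = long (code-return y el (≰⇒> |y|≰6) privW)
      where
      long : CodeReturn y → Privileged y
      long (v , privV , pre , 3≤|v| , |v|<|y| , cfr)
        with prefix01-long v (prefix-of-prefix w01 v y pre01 pre (≤-trans (m≤n+m 2 1) 3≤|v|)) 3≤|v|
      ... | a , v′ , refl =
        priv-return (rec |v|<|y| v refl (eligible-prefix v y el pre (s≤s (s≤s z≤n))) privV) |v|<|y|
          (code-cfr⁻ a v′ y (<⇒≤ |v|<|y|) cfr)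

-- Positions and lengths 4q + r, with 4q computed by doubling twice so that
-- the letter identities t(2i) = t(i), t(2i+1) = ¬t(i) apply directly.
quad : ℕ → ℕ
quad q = (q + q) + (q + q)

quad-suc : ∀ q → quad (suc q) ≡ suc (suc (suc (suc (quad q))))
quad-suc q rewrite +-suc q q | +-suc (q + q) (suc (q + q)) | +-suc (q + q) (q + q) = refl

quad≡*4 : ∀ q → quad q ≡ q * 4
quad≡*4 zero    = refl
quad≡*4 (suc q) = trans (quad-suc q) (cong (λ x → suc (suc (suc (suc x)))) (quad≡*4 q))

quad≡4* : ∀ q → quad q ≡ 4 * q
quad≡4* q = trans (quad≡*4 q) (*-comm q 4)

quad-mono-< : ∀ {a b} → a < b → quad a < quad b
quad-mono-< p = +-mono-< (+-mono-< p p) (+-mono-< p p)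

quad-mono-≤ : ∀ {a b} → a ≤ b → quad a ≤ quad b
quad-mono-≤ p = +-mono-≤ (+-mono-≤ p p) (+-mono-≤ p p)

t-quad₀ : ∀ q → t (quad q) ≡ t q
t-quad₀ q = trans (t-even (q + q)) (t-even q)

t-quad₁ : ∀ q → t (suc (quad q)) ≡ not (t q)
t-quad₁ q = trans (t-odd (q + q)) (cong not (t-even q))

t-quad₂ : ∀ q → t (suc (suc (quad q))) ≡ not (t q)
t-quad₂ q = trans (cong t (sym (+-suc (suc (q + q)) (q + q)))) (trans (t-even (suc (q + q))) (t-odd q))

t-quad₃ : ∀ q → t (suc (suc (suc (quad q)))) ≡ t q
t-quad₃ q = trans (cong (λ x → t (suc x)) (sym (+-suc (suc (q + q)) (q + q))))
              (trans (t-odd (suc (q + q))) (trans (cong not (t-odd q)) (not-involutive (t q))))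

t-next₀ : ∀ q → t (4 + quad q) ≡ t (suc q)
t-next₀ q = trans (cong t (sym (quad-suc q))) (t-quad₀ (suc q))

t-next₁ : ∀ q → t (5 + quad q) ≡ not (t (suc q))
t-next₁ q = trans (cong (λ x → t (suc x)) (sym (quad-suc q))) (t-quad₁ (suc q))

t-next₂ : ∀ q → t (6 + quad q) ≡ not (t (suc q))
t-next₂ q = trans (cong (λ x → t (suc (suc x))) (sym (quad-suc q))) (t-quad₂ (suc q))

quad-residue : ∀ r q → (r + quad q) % 4 ≡ r % 4
quad-residue r q = trans (cong (λ x → (r + x) % 4) (quad≡*4 q)) ([m+kn]%n≡m%n r q 4)

quad-division : ∀ ℓ → ℓ ≡ ℓ % 4 + quad (ℓ / 4)
quad-division ℓ = trans (m≡m%n+[m/n]*n ℓ 4) (cong (ℓ % 4 +_) (sym (quad≡*4 (ℓ / 4))))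

quad-cancel-< : ∀ {a b} → quad a < quad b → a < b
quad-cancel-< {a} {b} p = *-cancelʳ-< 4 a b (subst₂ _<_ (quad≡*4 a) (quad≡*4 b) p)

∸-reflects-< : ∀ {a b} c → a ∸ c < b ∸ c → a < b
∸-reflects-< {a} {b} c p with a <? b
... | yes a<b = a<b
... | no  a≮b = ⊥-elim (<⇒≱ p (∸-monoˡ-≤ c (≮⇒≥ a≮b)))

-- The coding φ: φ(y) is μ²(ȳ) with two letters removed at each end,
-- i.e. φ(b d …) = b b̄ d̄ d φ(d …).
φ : Word → Word
φ []          = []
φ (b ∷ [])    = []
φ (b ∷ d ∷ y) = b ∷ not b ∷ not d ∷ d ∷ φ (d ∷ y)

length-φ : ∀ b y → length (φ (b ∷ y)) ≡ quad (length y)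
length-φ b []      = refl
length-φ b (d ∷ y) = trans (cong (λ n → suc (suc (suc (suc n)))) (length-φ d y)) (sym (quad-suc (length y)))

seg-φ : ∀ q n → φ (complement (seg q (suc n))) ≡ seg (2 + quad q) (quad n)
seg-φ q zero    = refl
seg-φ q (suc n) = begin
  φ (complement (seg q (2 + n)))
    ≡⟨ cong (block ++_) (seg-φ (suc q) n) ⟩
  block ++ seg (2 + quad (suc q)) (quad n)
    ≡⟨ cong (λ x → block ++ seg (2 + x) (quad n)) (quad-suc q) ⟩
  block ++ seg (6 + quad q) (quad n)
    ≡⟨ cong₂ _∷_ (sym (t-quad₂ q)) (cong₂ _∷_ (trans (not-involutive (t q)) (sym (t-quad₃ q)))
         (cong₂ _∷_ (trans (not-involutive (t (suc q))) (sym (t-next₀ q))) (cong₂ _∷_ (sym (t-next₁ q)) refl))) ⟩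
  seg (2 + quad q) (4 + quad n)
    ≡⟨ cong (seg (2 + quad q)) (quad-suc n) ⟨
  seg (2 + quad q) (quad (suc n)) ∎
  where
  block : Word
  block = not (t q) ∷ not (not (t q)) ∷ not (not (t (suc q))) ∷ not (t (suc q)) ∷ []

φ-block : ∀ a b a′ d R → ((a ==b b) ∧ ((not a ==b not b) ∧ ((not a′ ==b not d) ∧ ((a′ ==b d) ∧ R))))
                      ≡ ((a ==b b) ∧ ((a′ ==b d) ∧ R))
φ-block a b a′ d R rewrite ==b-not a b | ==b-not a′ d | ∧-dup (a ==b b) ((a′ ==b d) ∧ ((a′ ==b d) ∧ R))
                         | ∧-dup (a′ ==b d) R = refl

φ-isPrefixB : ∀ a a′ v x → isPrefixB (φ (a ∷ a′ ∷ v)) (φ x) ≡ isPrefixB (a ∷ a′ ∷ v) x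
φ-isPrefixB a a′ v        []          = refl
φ-isPrefixB a a′ v        (b ∷ [])    = sym (∧-zeroʳ (a ==b b))
φ-isPrefixB a a′ []       (b ∷ d ∷ y) = φ-block a b a′ d true
φ-isPrefixB a a′ (a″ ∷ v) (b ∷ d ∷ y) = begin
  (a ==b b) ∧ ((not a ==b not b) ∧ ((not a′ ==b not d) ∧ ((a′ ==b d) ∧ isPrefixB (φ (a′ ∷ a″ ∷ v)) (φ (d ∷ y)))))
    ≡⟨ cong (λ R → (a ==b b) ∧ ((not a ==b not b) ∧ ((not a′ ==b not d) ∧ ((a′ ==b d) ∧ R))))
            (φ-isPrefixB a′ a″ v (d ∷ y)) ⟩
  (a ==b b) ∧ ((not a ==b not b) ∧ ((not a′ ==b not d) ∧ ((a′ ==b d) ∧ ((a′ ==b d) ∧ isPrefixB (a″ ∷ v) y))))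
    ≡⟨ φ-block a b a′ d _ ⟩
  (a ==b b) ∧ ((a′ ==b d) ∧ ((a′ ==b d) ∧ isPrefixB (a″ ∷ v) y))
    ≡⟨ cong ((a ==b b) ∧_) (∧-dup (a′ ==b d) _) ⟩
  (a ==b b) ∧ ((a′ ==b d) ∧ isPrefixB (a″ ∷ v) y) ∎

-- Inside φ(x), a word 0101R (such as φ(01v)) can only begin at the start
-- of a block b b̄ d̄ d: the letters at offsets 1, 2, 3 never begin 0101.
w0101 : Word → Word
w0101 R = false ∷ true ∷ false ∷ true ∷ R

φ-offset₁ : ∀ R b d y → isPrefixB (w0101 R) (not b ∷ not d ∷ d ∷ φ (d ∷ y)) ≡ false
φ-offset₁ R true  false []      = refl
φ-offset₁ R true  false (_ ∷ _) = refl
φ-offset₁ R true  true  []      = refl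
φ-offset₁ R true  true  (_ ∷ _) = refl
φ-offset₁ R false _     []      = refl
φ-offset₁ R false _     (_ ∷ _) = refl

φ-offset₂ : ∀ R d y → isPrefixB (w0101 R) (not d ∷ d ∷ φ (d ∷ y)) ≡ false
φ-offset₂ R true  []      = refl
φ-offset₂ R true  (_ ∷ _) = refl
φ-offset₂ R false []      = refl
φ-offset₂ R false (_ ∷ _) = refl

φ-offset₃ : ∀ R d y → isPrefixB (w0101 R) (d ∷ φ (d ∷ y)) ≡ false
φ-offset₃ R true  []      = refl
φ-offset₃ R true  (_ ∷ _) = refl
φ-offset₃ R false []      = refl
φ-offset₃ R false (_ ∷ _) = refl

φ-occ-block : ∀ R b d y →
  occ (w0101 R) (φ (b ∷ d ∷ y)) ≡ bit (isPrefixB (w0101 R) (φ (b ∷ d ∷ y))) + occ (w0101 R) (φ (d ∷ y))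
φ-occ-block R b d y rewrite φ-offset₁ R b d y | φ-offset₂ R d y | φ-offset₃ R d y = refl

φ-occ : ∀ v x → occ (φ (false ∷ true ∷ v)) (φ x) ≡ occ (false ∷ true ∷ v) x
φ-occ v []          = refl
φ-occ v (true ∷ [])  = refl
φ-occ v (false ∷ []) = refl
φ-occ v (b ∷ d ∷ y) =
  trans (φ-occ-block (φ (true ∷ v)) b d y)
        (cong₂ _+_ (cong bit (φ-isPrefixB false true v (b ∷ d ∷ y))) (φ-occ v (d ∷ y)))

φ-suffix : ∀ r a b w → IsSuffix (φ (a ∷ b ∷ w)) (φ (r ++ a ∷ b ∷ w))
φ-suffix []      a b w = [] , refl
φ-suffix (c ∷ r) a b w =
  suffix-trans (φ-suffix r a b w) (cons-suffix c (r ++ a ∷ b ∷ w) (≤-trans (s≤s z≤n) (length-++-≤ʳ (a ∷ b ∷ w) {r})))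
  where
  cons-suffix : ∀ c u → 1 ≤ length u → IsSuffix (φ u) (φ (c ∷ u))
  cons-suffix c (d ∷ u) _ = c ∷ not c ∷ not d ∷ d ∷ [] , refl

φ-prefix010 : ∀ y → 3 ≤ length y → IsPrefix w01 y → IsPrefix w010 (φ y)
φ-prefix010 .(false ∷ true ∷ r) _ (r , refl) = true ∷ φ (true ∷ r) , refl

φ-prefix01⁻ : ∀ y → 3 ≤ length y → IsPrefix w010 (φ y) → IsPrefix w01 y
φ-prefix01⁻ (false ∷ true  ∷ r) _ _        = r , refl
φ-prefix01⁻ (false ∷ false ∷ r) _ (_ , ())
φ-prefix01⁻ (true  ∷ d     ∷ r) _ (_ , ())

φ-length-onto : ∀ ℓ → 5 ≤ ℓ → ℓ % 4 ≡ 0 → Σ ℕ λ k → 3 ≤ k × ℓ ≡ quad (k ∸ 1)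
φ-length-onto ℓ 5≤ℓ ℓ%4≡0 = suc (ℓ / 4) , s≤s (quad-cancel-< (subst (4 <_) ℓ≡ 5≤ℓ)) , ℓ≡
  where
  ℓ≡ : ℓ ≡ quad (ℓ / 4)
  ℓ≡ = trans (quad-division ℓ) (cong (_+ quad (ℓ / 4)) ℓ%4≡0)

-- Since factors are closed under complementation, φ maps the factors of
-- length m onto the factors of length 4(m − 1) at positions ≡ 2 (mod 4).
φ-image : ∀ i m → 2 ≤ m → Σ ℕ λ j → j % 4 ≡ 2 × φ (seg i m) ≡ seg j (quad (m ∸ 1))
φ-image i (suc n) _ = 2 + quad i′ , quad-residue 2 i′ , image
  where
  K : ℕ
  K = i + suc n
  i′ : ℕ
  i′ = dbl^ K 1 + i
  image : φ (seg i (suc n)) ≡ seg (2 + quad i′) (quad n)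
  image = begin
    φ (seg i (suc n))                            ≡⟨ cong φ (complement-involutive (seg i (suc n))) ⟨
    φ (complement (complement (seg i (suc n))))
      ≡⟨ cong (λ w → φ (complement w)) (complement-seg K i (suc n) (<⇒≤ (n<2^n K))) ⟩
    φ (complement (seg i′ (suc n)))              ≡⟨ seg-φ i′ n ⟩
    seg (2 + quad i′) (quad n)                   ∎

φ-preimage : ∀ j m → 2 ≤ m → j % 4 ≡ 2 → Σ Word λ y → IsFactor y × length y ≡ m × seg j (quad (m ∸ 1)) ≡ φ y
φ-preimage j (suc n) _ j%4≡2 = complement (seg q (suc n)) , factor-complement _ (seg-factor q (suc n)) ,
  trans (length-map not (seg q (suc n))) (length-seg q (suc n)) ,
  trans (cong (λ x → seg x (quad n)) j≡) (sym (seg-φ q n))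
  where
  q : ℕ
  q = j / 4
  j≡ : j ≡ 2 + quad q
  j≡ = trans (quad-division j) (cong (_+ quad q) j%4≡2)

φ-coding : Coding
φ-coding = record
  { code              = φ
  ; codeLength        = λ m → quad (m ∸ 1)
  ; startResidue      = 2
  ; lengthResidue     = 0
  ; residues          = inj₁ (refl , refl)
  ; length-code       = λ { (b ∷ y) _ → length-φ b y }
  ; codeLength-mono   = λ 2≤a a<b → quad-mono-< (∸-monoˡ-< a<b (≤-trans (s≤s z≤n) 2≤a))
  ; codeLength-cancel = λ p → ∸-reflects-< 1 (quad-cancel-< p)
  ; codeLength-large  = λ 7≤m → ≤-trans (≤ᵇ⇒≤ 15 (quad 6) _) (quad-mono-≤ (∸-monoˡ-≤ 1 7≤m))
  ; codeLength-onto   = φ-length-onto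
  ; codeLength-residue = λ m → quad-residue 0 (m ∸ 1)
  ; codeLength-≥4     = λ 3≤m → ≤-trans (≤ᵇ⇒≤ 4 (quad 2) _) (quad-mono-≤ (∸-monoˡ-≤ 1 3≤m))
  ; isPrefixB-code    = φ-isPrefixB
  ; occ-code          = λ a v x → φ-occ (a ∷ v) x
  ; code-suffix       = φ-suffix
  ; code-prefix010    = φ-prefix010
  ; code-prefix01⁻    = φ-prefix01⁻
  ; image             = φ-image
  ; preimage          = φ-preimage
  ; small-cases       = small-cases-by-check φ _
  }

-- The coding ψ: ψ(y) is μ²(y) with three letters removed at each end,
-- i.e. ψ(b d e …) = b d d̄ d̄ ψ(d e …) and ψ(b d) = b d.
ψ : Word → Word
ψ []              = []
ψ (b ∷ [])        = []
ψ (b ∷ d ∷ [])    = b ∷ d ∷ []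
ψ (b ∷ d ∷ e ∷ y) = b ∷ d ∷ not d ∷ not d ∷ ψ (d ∷ e ∷ y)

length-ψ : ∀ b d y → length (ψ (b ∷ d ∷ y)) ≡ 2 + quad (length y)
length-ψ b d []      = refl
length-ψ b d (e ∷ y) = trans (cong (λ n → suc (suc (suc (suc n)))) (length-ψ d e y)) (cong (2 +_) (sym (quad-suc (length y))))

seg-ψ : ∀ q n → ψ (seg q (2 + n)) ≡ seg (3 + quad q) (2 + quad n)
seg-ψ q zero    = cong₂ (λ a b → a ∷ b ∷ []) (sym (t-quad₃ q)) (sym (t-next₀ q))
seg-ψ q (suc n) = begin
  ψ (seg q (2 + suc n))
    ≡⟨ cong (block ++_) (seg-ψ (suc q) n) ⟩
  block ++ seg (3 + quad (suc q)) (2 + quad n)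
    ≡⟨ cong (λ x → block ++ seg (3 + x) (2 + quad n)) (quad-suc q) ⟩
  block ++ seg (7 + quad q) (2 + quad n)
    ≡⟨ cong₂ _∷_ (sym (t-quad₃ q))
         (cong₂ _∷_ (sym (t-next₀ q)) (cong₂ _∷_ (sym (t-next₁ q)) (cong₂ _∷_ (sym (t-next₂ q)) refl))) ⟩
  seg (3 + quad q) (6 + quad n)
    ≡⟨ cong (λ x → seg (3 + quad q) (2 + x)) (quad-suc n) ⟨
  seg (3 + quad q) (2 + quad (suc n)) ∎
  where
  block : Word
  block = t q ∷ t (suc q) ∷ not (t (suc q)) ∷ not (t (suc q)) ∷ []

ψ-block : ∀ a b a′ d R → ((a ==b b) ∧ ((a′ ==b d) ∧ ((not a′ ==b not d) ∧ ((not a′ ==b not d) ∧ R))))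
                      ≡ ((a ==b b) ∧ ((a′ ==b d) ∧ R))
ψ-block a b a′ d R rewrite ==b-not a′ d | ∧-dup (a′ ==b d) ((a′ ==b d) ∧ R) | ∧-dup (a′ ==b d) R = refl

ψ-isPrefixB : ∀ a a′ v x → isPrefixB (ψ (a ∷ a′ ∷ v)) (ψ x) ≡ isPrefixB (a ∷ a′ ∷ v) x
ψ-isPrefixB a a′ []       []              = refl
ψ-isPrefixB a a′ (_ ∷ _)  []              = refl
ψ-isPrefixB a a′ []       (b ∷ [])        = sym (∧-zeroʳ (a ==b b))
ψ-isPrefixB a a′ (_ ∷ _)  (b ∷ [])        = sym (∧-zeroʳ (a ==b b))
ψ-isPrefixB a a′ []       (b ∷ d ∷ [])    = refl
ψ-isPrefixB a a′ (_ ∷ _)  (b ∷ d ∷ [])    = refl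
ψ-isPrefixB a a′ []       (b ∷ d ∷ e ∷ y) = refl
ψ-isPrefixB a a′ (a″ ∷ v) (b ∷ d ∷ e ∷ y) = begin
  (a ==b b) ∧ ((a′ ==b d) ∧ ((not a′ ==b not d) ∧ ((not a′ ==b not d) ∧
    isPrefixB (ψ (a′ ∷ a″ ∷ v)) (ψ (d ∷ e ∷ y)))))
    ≡⟨ cong (λ R → (a ==b b) ∧ ((a′ ==b d) ∧ ((not a′ ==b not d) ∧ ((not a′ ==b not d) ∧ R))))
            (ψ-isPrefixB a′ a″ v (d ∷ e ∷ y)) ⟩
  (a ==b b) ∧ ((a′ ==b d) ∧ ((not a′ ==b not d) ∧ ((not a′ ==b not d) ∧ ((a′ ==b d) ∧ isPrefixB (a″ ∷ v) (e ∷ y)))))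
    ≡⟨ ψ-block a b a′ d _ ⟩
  (a ==b b) ∧ ((a′ ==b d) ∧ ((a′ ==b d) ∧ isPrefixB (a″ ∷ v) (e ∷ y)))
    ≡⟨ cong ((a ==b b) ∧_) (∧-dup (a′ ==b d) _) ⟩
  (a ==b b) ∧ ((a′ ==b d) ∧ isPrefixB (a″ ∷ v) (e ∷ y)) ∎

-- Inside ψ(x), a word 0100R (such as ψ(01av)) can only begin at the start
-- of a block b d d̄ d̄: the letters at offsets 1, 2, 3 never begin 0100.
w0100 : Word → Word
w0100 R = false ∷ true ∷ false ∷ false ∷ R

ψ-offset₁ : ∀ R d e y → isPrefixB (w0100 R) (d ∷ not d ∷ not d ∷ ψ (d ∷ e ∷ y)) ≡ false
ψ-offset₁ R true  _ []      = refl
ψ-offset₁ R true  _ (_ ∷ _) = refl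
ψ-offset₁ R false _ []      = refl
ψ-offset₁ R false _ (_ ∷ _) = refl

ψ-offset₂ : ∀ R d e y → isPrefixB (w0100 R) (not d ∷ not d ∷ ψ (d ∷ e ∷ y)) ≡ false
ψ-offset₂ R true  _ []      = refl
ψ-offset₂ R true  _ (_ ∷ _) = refl
ψ-offset₂ R false _ []      = refl
ψ-offset₂ R false _ (_ ∷ _) = refl

ψ-offset₃ : ∀ R d e y → isPrefixB (w0100 R) (not d ∷ ψ (d ∷ e ∷ y)) ≡ false
ψ-offset₃ R false _     []      = refl
ψ-offset₃ R false _     (_ ∷ _) = refl
ψ-offset₃ R true  true  []      = refl
ψ-offset₃ R true  true  (_ ∷ _) = refl
ψ-offset₃ R true  false []      = refl
ψ-offset₃ R true  false (_ ∷ _) = refl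

ψ-occ-block : ∀ R b d e y → occ (w0100 R) (ψ (b ∷ d ∷ e ∷ y)) ≡
  bit (isPrefixB (w0100 R) (ψ (b ∷ d ∷ e ∷ y))) + occ (w0100 R) (ψ (d ∷ e ∷ y))
ψ-occ-block R b d e y rewrite ψ-offset₁ R d e y | ψ-offset₂ R d e y | ψ-offset₃ R d e y = refl

ψ-occ : ∀ a v x → occ (ψ (false ∷ true ∷ a ∷ v)) (ψ x) ≡ occ (false ∷ true ∷ a ∷ v) x
ψ-occ a v []                  = refl
ψ-occ a v (true ∷ [])         = refl
ψ-occ a v (false ∷ [])        = refl
ψ-occ a v (true ∷ true ∷ [])   = refl
ψ-occ a v (true ∷ false ∷ [])  = refl
ψ-occ a v (false ∷ true ∷ [])  = refl
ψ-occ a v (false ∷ false ∷ []) = refl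
ψ-occ a v (b ∷ d ∷ e ∷ y) =
  trans (ψ-occ-block (ψ (true ∷ a ∷ v)) b d e y)
        (cong₂ _+_ (cong bit (ψ-isPrefixB false true (a ∷ v) (b ∷ d ∷ e ∷ y))) (ψ-occ a v (d ∷ e ∷ y)))

ψ-suffix : ∀ r a b w → IsSuffix (ψ (a ∷ b ∷ w)) (ψ (r ++ a ∷ b ∷ w))
ψ-suffix []      a b w = [] , refl
ψ-suffix (c ∷ r) a b w =
  suffix-trans (ψ-suffix r a b w) (cons-suffix c (r ++ a ∷ b ∷ w) (≤-trans (s≤s (s≤s z≤n)) (length-++-≤ʳ (a ∷ b ∷ w) {r})))
  where
  cons-suffix : ∀ c u → 2 ≤ length u → IsSuffix (ψ u) (ψ (c ∷ u))
  cons-suffix c (d ∷ e ∷ u) _ = c ∷ d ∷ not d ∷ not d ∷ [] , refl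
  cons-suffix c (d ∷ []) (s≤s ())

ψ-prefix010 : ∀ y → 3 ≤ length y → IsPrefix w01 y → IsPrefix w010 (ψ y)
ψ-prefix010 .(false ∷ true ∷ a ∷ r) _ (a ∷ r , refl) = false ∷ ψ (true ∷ a ∷ r) , refl
ψ-prefix010 .(false ∷ true ∷ []) (s≤s (s≤s ())) ([] , refl)

ψ-prefix01⁻ : ∀ y → 3 ≤ length y → IsPrefix w010 (ψ y) → IsPrefix w01 y
ψ-prefix01⁻ (false ∷ true  ∷ r)     _ _        = r , refl
ψ-prefix01⁻ (false ∷ false ∷ e ∷ r) _ (_ , ())
ψ-prefix01⁻ (true  ∷ d     ∷ e ∷ r) _ (_ , ())

ψ-length-onto : ∀ ℓ → 5 ≤ ℓ → ℓ % 4 ≡ 2 → Σ ℕ λ k → 3 ≤ k × ℓ ≡ 2 + quad (k ∸ 2)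
ψ-length-onto ℓ 5≤ℓ ℓ%4≡2 =
  suc (suc (ℓ / 4)) , s≤s (s≤s (quad-cancel-< (≤-trans (s≤s z≤n) (≤-pred (≤-pred (subst (5 ≤_) ℓ≡ 5≤ℓ)))))) , ℓ≡
  where
  ℓ≡ : ℓ ≡ 2 + quad (ℓ / 4)
  ℓ≡ = trans (quad-division ℓ) (cong (_+ quad (ℓ / 4)) ℓ%4≡2)

ψ-image : ∀ i m → 2 ≤ m → Σ ℕ λ j → j % 4 ≡ 3 × ψ (seg i m) ≡ seg j (2 + quad (m ∸ 2))
ψ-image i (suc (suc n)) _ = 3 + quad i , quad-residue 3 i , seg-ψ i n
ψ-image i (suc zero) (s≤s ())

ψ-preimage : ∀ j m → 2 ≤ m → j % 4 ≡ 3 → Σ Word λ y → IsFactor y × length y ≡ m × seg j (2 + quad (m ∸ 2)) ≡ ψ y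
ψ-preimage j (suc (suc n)) _ j%4≡3 = seg q (2 + n) , seg-factor q (2 + n) , length-seg q (2 + n) ,
  trans (cong (λ x → seg x (2 + quad n)) j≡) (sym (seg-ψ q n))
  where
  q : ℕ
  q = j / 4
  j≡ : j ≡ 3 + quad q
  j≡ = trans (quad-division j) (cong (_+ quad q) j%4≡3)
ψ-preimage j (suc zero) (s≤s ()) _

ψ-coding : Coding
ψ-coding = record
  { code              = ψ
  ; codeLength        = λ m → 2 + quad (m ∸ 2)
  ; startResidue      = 3
  ; lengthResidue     = 2
  ; residues          = inj₂ (refl , refl)
  ; length-code       = λ { (b ∷ d ∷ y) _ → length-ψ b d y ; (b ∷ []) (s≤s ()) }
  ; codeLength-mono   = λ 2≤a a<b → s≤s (s≤s (quad-mono-< (∸-monoˡ-< a<b 2≤a)))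
  ; codeLength-cancel = λ p → ∸-reflects-< 2 (quad-cancel-< (≤-pred (≤-pred p)))
  ; codeLength-large  = λ 7≤m → s≤s (s≤s (≤-trans (≤ᵇ⇒≤ 13 (quad 5) _) (quad-mono-≤ (∸-monoˡ-≤ 2 7≤m))))
  ; codeLength-onto   = ψ-length-onto
  ; codeLength-residue = λ m → quad-residue 2 (m ∸ 2)
  ; codeLength-≥4     = λ 3≤m → s≤s (s≤s (≤-trans (≤ᵇ⇒≤ 2 (quad 1) _) (quad-mono-≤ (∸-monoˡ-≤ 2 3≤m))))
  ; isPrefixB-code    = ψ-isPrefixB
  ; occ-code          = ψ-occ
  ; code-suffix       = ψ-suffix
  ; code-prefix010    = ψ-prefix010
  ; code-prefix01⁻    = ψ-prefix01⁻
  ; image             = ψ-image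
  ; preimage          = ψ-preimage
  ; small-cases       = small-cases-by-check ψ _
  }

Enumerates : List Word → (Word → Set) → Set
Enumerates xs P = Unique xs × (∀ w → (w ∈ xs → P w) × (P w → w ∈ xs))

enumeration-count : ∀ {P} xs → Enumerates xs P → HasCount P (length xs)
enumeration-count xs (unique , members) = xs , refl , unique , members

filter-enumerates : ∀ {P Q : Word → Set} (p : Word → Bool) xs → Enumerates xs P →
  (∀ w → Q w → P w × T (p w)) → (∀ w → P w → T (p w) → Q w) → Enumerates (filterᵇ p xs) Q
filter-enumerates p xs (unique , members) Q⇒ ⇒Q =
  filter⁺ (λ v → T? (p v)) unique ,
  λ w → (λ w∈ → let (w∈xs , pw) = ∈-filter⁻ (λ v → T? (p v)) w∈ in ⇒Q w (proj₁ (members w) w∈xs) pw) ,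
        (λ Qw → ∈-filter⁺ (λ v → T? (p v)) (proj₂ (members w) (proj₁ (Q⇒ w Qw))) (proj₂ (Q⇒ w Qw)))

-- map preserves duplicate-freeness when f is injective on the members (the
-- library's map⁺ asks for injectivity everywhere, which codings lack).
map-unique : ∀ (f : Word → Word) xs → (∀ {x y} → x ∈ xs → y ∈ xs → f x ≡ f y → x ≡ y) →
  Unique xs → Unique (map f xs)
map-unique f []       _   []         = []
map-unique f (x ∷ xs) inj (x∉xs ∷ u) =
  All.map⁺ (All.tabulate (λ y∈xs fx≡fy → All.lookup x∉xs y∈xs (inj (here refl) (there y∈xs) fx≡fy))) ∷
  map-unique f xs (λ x∈ y∈ → inj (there x∈) (there y∈)) u

map-enumerates : ∀ {P Q : Word → Set} (f : Word → Word) xs → Enumerates xs P →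
  (∀ x y → P x → P y → f x ≡ f y → x ≡ y) → (∀ y → P y → Q (f y)) →
  (∀ w → Q w → Σ Word λ y → P y × w ≡ f y) → Enumerates (map f xs) Q
map-enumerates {Q = Q} f xs (unique , members) inj image preimage =
  map-unique f xs (λ x∈ y∈ → inj _ _ (proj₁ (members _) x∈) (proj₁ (members _) y∈)) unique ,
  λ w → (λ w∈ → let (y , y∈ , w≡) = ∈-map⁻ f w∈ in subst Q (sym w≡) (image y (proj₁ (members y) y∈))) ,
        (λ Qw → let (y , Py , w≡) = preimage w Qw in subst (_∈ map f xs) (sym w≡) (∈-map⁺ f (proj₂ (members y) Py)))

length-filter-split : ∀ (p q : Word → Bool) xs → (∀ x → x ∈ xs → q x ≡ not (p x)) →
  length (filterᵇ p xs) + length (filterᵇ q xs) ≡ length xs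
length-filter-split p q []       _ = refl
length-filter-split p q (x ∷ xs) h with p x | q x | h x (here refl) | length-filter-split p q xs (λ y y∈ → h y (there y∈))
... | true  | false | _ | split = cong suc split
... | false | true  | _ | split = trans (+-suc _ _) (cong suc split)

-- Enumerating the factors of t of length m: they are the windows of length
-- m at offsets r < 2ᵐ in the four blocks μᵐ(ab).
blockWindow : ℕ → Bool → Bool → ℕ → Word
blockWindow m a b r = take m (drop r (μ^ m (a ∷ b ∷ [])))

candidates : ℕ → ℕ → List Word
candidates m zero    = []
candidates m (suc R) = blockWindow m true true R ∷ blockWindow m true false R ∷
                       blockWindow m false true R ∷ blockWindow m false false R ∷ candidates m R

candidates-sound : ∀ m R {w} → w ∈ candidates m R →
  Σ Bool λ a → Σ Bool λ b → Σ ℕ λ r → r < R × w ≡ blockWindow m a b r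
candidates-sound m (suc R) (here refl)                         = true  , true  , R , ≤-refl , refl
candidates-sound m (suc R) (there (here refl))                 = true  , false , R , ≤-refl , refl
candidates-sound m (suc R) (there (there (here refl)))         = false , true  , R , ≤-refl , refl
candidates-sound m (suc R) (there (there (there (here refl)))) = false , false , R , ≤-refl , refl
candidates-sound m (suc R) (there (there (there (there w∈)))) with candidates-sound m R w∈
... | a , b , r , r<R , w≡ = a , b , r , m≤n⇒m≤1+n r<R , w≡

candidates-complete : ∀ m R a b r → r < R → blockWindow m a b r ∈ candidates m R
candidates-complete m (suc R) a b r (s≤s r≤R) with r ≟ℕ R
candidates-complete m (suc R) true  true  r _ | yes refl = here refl
candidates-complete m (suc R) true  false r _ | yes refl = there (here refl)
candidates-complete m (suc R) false true  r _ | yes refl = there (there (here refl))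
candidates-complete m (suc R) false false r _ | yes refl = there (there (there (here refl)))
... | no r≢R = there (there (there (there (candidates-complete m R a b r (≤∧≢⇒< r≤R r≢R)))))

pair-position : ∀ a b → Σ ℕ λ q → t q ≡ a × t (suc q) ≡ b
pair-position true  true  = 1 , refl , refl
pair-position true  false = 2 , refl , refl
pair-position false true  = 0 , refl , refl
pair-position false false = 5 , refl , refl

window-seg : ∀ m q r → r < dbl^ m 1 → blockWindow m (t q) (t (suc q)) r ≡ seg (dbl^ m q + r) m
window-seg m q r r<2^m = sym (seg-in-block m q r m fits)
  where
  fits : r + m ≤ dbl^ m 2
  fits = subst (r + m ≤_) (sym (dbl^-two m)) (+-mono-≤ (<⇒≤ r<2^m) (<⇒≤ (n<2^n m)))

candidate-factor : ∀ m {w} → w ∈ candidates m (dbl^ m 1) → length w ≡ m × IsFactor w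
candidate-factor m w∈ with candidates-sound m (dbl^ m 1) w∈
... | a , b , r , r< , refl with pair-position a b
... | q , refl , refl = subst (λ w → length w ≡ m × IsFactor w) (sym (window-seg m q r r<))
                          (length-seg _ m , seg-factor _ m)

factor-candidate : ∀ m w → length w ≡ m → IsFactor w → w ∈ candidates m (dbl^ m 1)
factor-candidate m w refl fw with factor-seg w fw
... | i , w≡ with seg-as-window m i m (<⇒≤ (n<2^n m))
... | q , r , r< , _ , seg≡ =
  subst (_∈ candidates m (dbl^ m 1)) (sym (trans w≡ seg≡)) (candidates-complete m _ (t q) (t (suc q)) r r<)

goodB : Word → Bool
goodB w = privB w ∧ isPrefixB w01 w

privilegedFactors01 : ℕ → List Word
privilegedFactors01 m = deduplicate _≟ᵂ_ (filterᵇ goodB (candidates m (dbl^ m 1)))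

privilegedFactors01-enumerates : ∀ m → Enumerates (privilegedFactors01 m) (PrivFactorWithPrefix w01 m)
privilegedFactors01-enumerates m = deduplicate-! _ , λ w → sound w , complete w
  where
  good? : (v : Word) → Dec (T (goodB v))
  good? = λ v → T? (goodB v)
  sound : ∀ w → w ∈ privilegedFactors01 m → PrivFactorWithPrefix w01 m w
  sound w w∈ with ∈-filter⁻ good? (∈-deduplicate⁻ _≟ᵂ_ _ w∈)
  ... | w∈cands , good with candidate-factor m w∈cands | T-∧⁻ {privB w} good
  ... | |w|≡m , fw | privW , preW = |w|≡m , fw , privB-sound w privW , isPrefixB-sound w01 w preW
  complete : ∀ w → PrivFactorWithPrefix w01 m w → w ∈ privilegedFactors01 m
  complete w (|w|≡m , fw , privW , preW) =
    ∈-deduplicate⁺ _≟ᵂ_ (∈-filter⁺ good? (factor-candidate m w |w|≡m fw)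
      (T-∧⁺ (privB-complete w privW) (isPrefixB-complete w01 w preW)))

module CodingCount (𝒞 : Coding) where
  open Coding 𝒞
  open CodingProperties 𝒞

  -- By the position-class theorem, a privileged factor of length codeLength m
  -- beginning with 010 sits at a position ≡ startResidue.
  image-position : ∀ m i → 3 ≤ m → Privileged (seg i (codeLength m)) → IsPrefix w010 (seg i (codeLength m)) →
    i % 4 ≡ startResidue
  image-position m i 3≤m priv pre =
    admissible-start (position-class (codeLength m) i (codeLength-≥4 3≤m) priv pre)
                     (subst (Admissible startResidue) (sym (codeLength-residue m)) residues)

  code-enumerates : ∀ m → 3 ≤ m →
    Enumerates (map code (privilegedFactors01 m)) (PrivFactorWithPrefix w010 (codeLength m))
  code-enumerates m 3≤m = map-enumerates code _ (privilegedFactors01-enumerates m) injective forward backward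
    where
    2≤m : 2 ≤ m
    2≤m = ≤-trans (m≤n+m 2 1) 3≤m
    P : Word → Set
    P = PrivFactorWithPrefix w01 m
    injective : ∀ x y → P x → P y → code x ≡ code y → x ≡ y
    injective x y (|x|≡m , _) (|y|≡m , _) = code-injective x y (subst (2 ≤_) (sym |x|≡m) 2≤m) (trans |x|≡m (sym |y|≡m))
    forward : ∀ y → P y → PrivFactorWithPrefix w010 (codeLength m) (code y)
    forward y (refl , fy , privY , preY) with factor-seg y fy
    ... | i , y≡ with image i (length y) 2≤m
    ... | j , _ , img = length-code y 2≤m ,
                        subst IsFactor (sym (trans (cong code y≡) (trans img (cong (seg j) (sym (length-code y 2≤m))))))
                          (seg-factor j (length (code y))) ,
                        privileged⁺ (length y) y refl (fy , preY , 2≤m) privY ,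
                        code-prefix010 y 3≤m preY
    backward : ∀ w → PrivFactorWithPrefix w010 (codeLength m) w → Σ Word λ y → P y × w ≡ code y
    backward w (|w|≡L , fw , privW , preW) with factor-seg-of-length w fw |w|≡L
    ... | i , w≡ with preimage i m 2≤m (image-position m i 3≤m (subst Privileged w≡ privW) (subst (IsPrefix w010) w≡ preW))
    ... | y , fy , |y|≡m , seg≡ = y , (|y|≡m , fy , privY , preY) , w≡code-y
      where
      w≡code-y : w ≡ code y
      w≡code-y = trans w≡ seg≡
      3≤|y| : 3 ≤ length y
      3≤|y| = subst (3 ≤_) (sym |y|≡m) 3≤m
      preY : IsPrefix w01 y
      preY = code-prefix01⁻ y 3≤|y| (subst (IsPrefix w010) w≡code-y preW)
      privY : Privileged y
      privY = privileged⁻ (length y) y refl (fy , preY , ≤-trans (m≤n+m 2 1) 3≤|y|) (subst Privileged w≡code-y privW)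

  code-count : ∀ m → 3 ≤ m → 𝒜≡ w010 (codeLength m) (length (privilegedFactors01 m))
  code-count m 3≤m = subst (HasCount _) (length-map code (privilegedFactors01 m))
                       (enumeration-count _ (code-enumerates m 3≤m))

prefix-count : ∀ m u → IsPrefix w01 u →
  𝒜≡ u m (length (filterᵇ (isPrefixB u) (privilegedFactors01 m)))
prefix-count m u pre01 = enumeration-count _ (filter-enumerates (isPrefixB u) _ (privilegedFactors01-enumerates m) narrow widen)
  where
  narrow : ∀ w → PrivFactorWithPrefix u m w → PrivFactorWithPrefix w01 m w × T (isPrefixB u w)
  narrow w (|w| , fw , privW , preW) = (|w| , fw , privW , prefix-trans pre01 preW) , isPrefixB-complete u w preW
  widen : ∀ w → PrivFactorWithPrefix w01 m w → T (isPrefixB u w) → PrivFactorWithPrefix u m w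
  widen w (|w| , fw , privW , _) h = |w| , fw , privW , isPrefixB-sound u w h

-- A privileged factor of length ≥ 3 beginning with 01 begins with exactly
-- one of 010 and 0110: 011 is not privileged and 0111 contains the
-- non-factor 111.
prefix-dichotomy : ∀ y → IsFactor y → Privileged y → IsPrefix w01 y → 3 ≤ length y →
  isPrefixB w0110 y ≡ not (isPrefixB w010 y)
prefix-dichotomy .(false ∷ true ∷ []) _ _ ([] , refl) (s≤s (s≤s ()))
prefix-dichotomy .(false ∷ true ∷ false ∷ r) _ _ (false ∷ r , refl) _ = refl
prefix-dichotomy .(false ∷ true ∷ true ∷ []) _ privY (true ∷ [] , refl) _ = ⊥-elim (privB-complete _ privY)
prefix-dichotomy .(false ∷ true ∷ true ∷ false ∷ r) _ _ (true ∷ false ∷ r , refl) _ = refl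
prefix-dichotomy y@.(false ∷ true ∷ true ∷ true ∷ r) fy _ (true ∷ true ∷ r , refl) _ with factor-seg y fy
... | i , y≡ = ⊥-elim (no-111 (i + 1) (trans (seg-window i 1 3 (length y) (s≤s (s≤s (s≤s (s≤s z≤n)))))
                                             (cong (λ w → take 3 (drop 1 w)) (sym y≡))))

φ-length : ∀ n → quad ((n + 1) ∸ 1) ≡ 4 * n
φ-length n = trans (cong quad (m+n∸n≡m n 1)) (quad≡4* n)

ψ-length : ∀ n → 1 ≤ n → 2 + quad ((n + 1) ∸ 2) ≡ 4 * n ∸ 2
ψ-length (suc n) _ = trans (cong (λ k → 2 + quad k) (m+n∸n≡m n 1))
                           (cong (_∸ 2) (trans (sym (quad-suc n)) (quad≡4* (suc n))))

corollary4p17 : (n : ℕ) → 2 ≤ n →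
    Σ ℕ λ a → Σ ℕ λ b → Σ ℕ λ c → Σ ℕ λ d →
      𝒜≡ w010 (4 * n) a × 𝒜≡ w010 (n + 1) b × 𝒜≡ w0110 (n + 1) c ×
      𝒜≡ w010 (4 * n ∸ 2) d × a ≡ b + c × d ≡ a
corollary4p17 n 2≤n =
  length S , length S₀₁₀ , length S₀₁₁₀ , length S ,
  subst (λ L → 𝒜≡ w010 L (length S)) (φ-length n) (CodingCount.code-count φ-coding m 3≤m) ,
  prefix-count m w010 (false ∷ [] , refl) ,
  prefix-count m w0110 (true ∷ false ∷ [] , refl) ,
  subst (λ L → 𝒜≡ w010 L (length S)) (ψ-length n (≤-trans (s≤s z≤n) 2≤n)) (CodingCount.code-count ψ-coding m 3≤m) ,
  sym (length-filter-split (isPrefixB w010) (isPrefixB w0110) S dichotomy) ,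
  refl
  where
  m : ℕ
  m = n + 1
  3≤m : 3 ≤ m
  3≤m = subst (3 ≤_) (+-comm 1 n) (s≤s 2≤n)
  S : List Word
  S = privilegedFactors01 m
  S₀₁₀ : List Word
  S₀₁₀ = filterᵇ (isPrefixB w010) S
  S₀₁₁₀ : List Word
  S₀₁₁₀ = filterᵇ (isPrefixB w0110) S
  dichotomy : ∀ y → y ∈ S → isPrefixB w0110 y ≡ not (isPrefixB w010 y)
  dichotomy y y∈S with proj₁ (proj₂ (privilegedFactors01-enumerates m) y) y∈S
  ... | |y|≡m , fy , privY , preY = prefix-dichotomy y fy privY preY (subst (3 ≤_) (sym |y|≡m) 3≤m)
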